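{- For every $n\ge1$, the number of matrices in $Sp_{2n}(\mathbb{Z}_2)$ having an even number of entries equal to $1$ is exactly $$2^{n^2-1}[2]_2\cdots[2n-2]_2\,([2n]_2-1),$$ while the number of matrices in $Sp_{2n}(\mathbb{Z}_2)$ having an odd number of entries equal to $1$ is $$2^{n^2-1}[2]_2\cdots[2n-2]_2\,([2n]_2+1).$$
   Context: Let $J$ be the $n\times n$ matrix with $1$'s on the antidiagonal and $0$ elsewhere, and $M=\begin{pmatrix}0&J\\-J&0\end{pmatrix}$. Then $Sp_{2n}(\mathbb{Z}_2)=\{A\in SL_{2n}(\mathbb{Z}_2): A^TMA=M\}$. For $m\ge1$, $[m]_2=1+2+\cdots+2^{m-1}=2^m-1$; an empty product equals $1$. -}

module Defs where

open import Data.Bool.Base using (Bool; true; false; _∧_; _xor_; if_then_else_)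
open import Data.Nat.Base using (ℕ; zero; suc; _+_; _*_; _∸_; _^_; _%_; _≡ᵇ_)
open import Data.Fin.Base using (Fin; toℕ; splitAt; zero; suc)
open import Data.Sum.Base using (inj₁; inj₂)
open import Data.Vec.Base using (Vec; lookup; tabulate; foldr′; sum; map; countᵇ; []; _∷_)
open import Data.Product.Base using (Σ; _×_)
open import Relation.Binary.PropositionalEquality using (_≡_)

-- Z₂ is modelled by Bool: false = 0, true = 1, xor = addition, ∧ = multiplication.
-- (In characteristic 2, -1 = 1.)

Mat : ℕ → Set
Mat m = Vec (Vec Bool m) m

entry : ∀ {m} → Mat m → Fin m → Fin m → Bool
entry A i j = lookup (lookup A i) j

Σ₂ : ∀ {m} → (Fin m → Bool) → Bool
Σ₂ f = foldr′ _xor_ false (tabulate f)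

transpose : ∀ {m} → Mat m → Mat m
transpose A = tabulate λ i → tabulate λ j → entry A j i

_⊗_ : ∀ {m} → Mat m → Mat m → Mat m
A ⊗ B = tabulate λ i → tabulate λ j → Σ₂ λ k → entry A i k ∧ entry B k j

-- determinant over Z₂ by Laplace expansion along the first row
-- (signs are irrelevant in characteristic 2)
removeAt : ∀ {m} {X : Set} → Vec X (suc m) → Fin (suc m) → Vec X m
removeAt (x ∷ xs) zero = xs
removeAt {suc m} (x ∷ xs) (suc i) = x ∷ removeAt xs i

minor : ∀ {m} → Mat (suc m) → Fin (suc m) → Mat m
minor (r ∷ rs) j = map (λ row → removeAt row j) rs

det : ∀ {m} → Mat m → Bool
det {zero} [] = true
det {suc m} A = Σ₂ λ j → entry A zero j ∧ det (minor A j)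

Jent : (n : ℕ) → Fin n → Fin n → Bool
Jent n i j = (toℕ i + toℕ j) ≡ᵇ (n ∸ 1)

-- M = [[0, J], [-J, 0]]  (over Z₂, -J = J), of size (n + n)
Mform : (n : ℕ) → Mat (n + n)
Mform n = tabulate λ i → tabulate λ j → blk (splitAt n i) (splitAt n j)
  where
  blk : _ → _ → Bool
  blk (inj₁ a) (inj₂ b) = Jent n a b
  blk (inj₂ a) (inj₁ b) = Jent n a b
  blk _ _ = false

IsSp : (n : ℕ) → Mat (n + n) → Set
IsSp n A = (det A ≡ true) × (transpose A ⊗ (Mform n ⊗ A) ≡ Mform n)

ones : ∀ {m} → Mat m → ℕ
ones A = sum (map (countᵇ (λ b → b)) A)

q2 : ℕ → ℕ
q2 m = 2 ^ m ∸ 1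

prodEven : ℕ → ℕ
prodEven zero = 1
prodEven (suc k) = prodEven k * q2 (2 * suc k)

SpEven : ℕ → Set
SpEven n = Σ (Mat (n + n)) λ A → IsSp n A × (ones A % 2 ≡ 0)

SpOdd : ℕ → Set
SpOdd n = Σ (Mat (n + n)) λ A → IsSp n A × (ones A % 2 ≡ 1)

{-# OPTIONS --safe #-}
module Submission where

-- Write C for the transpose of A. The condition AᵀMA = M says that the rows of C form a symplectic
-- basis for the alternating form ω(x, y) = Σₖ xₖ y₂ₙ₋₁₋ₖ, and the number of ones of A has the parity
-- of the sum of all entries of C. The determinant condition is automatic: every symplectic basis is
-- obtained from diag(1, B, 1), with B a symplectic basis of size 2n - 2, by transvections
-- x ↦ x + ω(x, u) u, and these act on Cᵀ by row operations of determinant 1.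
--
-- The transvection along u = (0, 1, …, 1), applied to the row indices, is an involution on symplectic
-- bases that turns the total parity into the parity of the first row. Transvections act transitively
-- on hyperbolic pairs with stabiliser Sp₂ₙ₋₂, so symplectic bases whose first row lies in a set P
-- correspond to the pairs (e, f) with e ∈ P and ω(e, f) = 1, times Sp₂ₙ₋₂. Every e ≠ 0 has 2²ⁿ⁻¹
-- partners f, there are 2²ⁿ⁻¹ - 1 nonzero even and 2²ⁿ⁻¹ odd vectors e, and the same recursion gives
-- |Sp₂ₙ₋₂| = 2^((n-1)²) [2]₂ ⋯ [2n-2]₂.

open import Defs

open import Algebra.Bundles using (CommutativeRing; CommutativeMonoid)
open import Axiom.UniquenessOfIdentityProofs.WithK using (uip)
open import Data.Bool.Base using (Bool; true; false; not; _∧_; _∨_; _xor_; if_then_else_)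
open import Data.Bool.Properties
  using (xor-∧-commutativeRing; xor-comm; xor-assoc; xor-same; xor-identityʳ; ∧-comm; ∧-assoc; ∧-zeroʳ;
         ∧-distribˡ-xor; ∧-distribʳ-xor; ∧-conicalˡ; ∧-commutativeMonoid; T-≡)
open import Data.Empty using (⊥-elim)
open import Data.Fin.Base using (Fin; zero; suc; toℕ; opposite; fromℕ; inject₁; splitAt)
open import Data.Fin.Properties
  using (toℕ-injective; toℕ-inject₁; toℕ<n; toℕ-↑ˡ; toℕ-↑ʳ; splitAt⁻¹-↑ˡ; splitAt⁻¹-↑ʳ; suc-injective; fromℕ≢inject₁;
         opposite-involutive; opposite-prop; +↔⊎; *↔×)
open import Data.List.Base using (List; []; _∷_; _++_)
open import Data.Nat.Base using (ℕ; zero; suc; _+_; _*_; _∸_; _^_; _%_; _≡ᵇ_; _<_; _≤_; s≤s⁻¹)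
open import Data.Nat.DivMod using (%-distribˡ-+)
open import Data.Nat.Properties
  using (≡ᵇ⇒≡; ≡⇒≡ᵇ; +-identityʳ; +-assoc; +-comm; +-commutativeSemigroup; <⇒≢; >⇒≢; +-mono-≤-<; +-mono-≤; m≤m+n;
         m+n∸m≡n; m+[n∸m]≡n; m∸n+n≡m; ∸-+-assoc; *-distribˡ-∸; ^-distribˡ-+-*; m^n>0)
open import Data.Nat.Tactic.RingSolver using (solve-∀)
open import Data.Product.Base using (Σ; ∃; _×_; _,_; proj₁; proj₂)
open import Data.Product.Function.Dependent.Propositional using (congˡ)
open import Data.Product.Function.NonDependent.Propositional using (_×-↔_)
open import Data.Sum.Base using (_⊎_; inj₁; inj₂)
open import Data.Sum.Function.Propositional using (_⊎-↔_)
open import Data.Vec.Base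
  using (Vec; []; _∷_; _∷ʳ_; head; lookup; tabulate; map; zipWith; replicate; sum; countᵇ; _[_]≔_)
open import Data.Vec.Properties
  using (lookup∘tabulate; tabulate∘lookup; tabulate-cong; lookup-map; lookup-zipWith; map-id; map-∘; map-cong; map-∷ʳ;
         map-[]≔; []≔-commutes; []≔-lookup; lookup∘update; lookup∘update′)
open import Function.Base using (_∘_; _$_)
open import Function.Bundles using (Equivalence; _↔_; _⇔_; mk↔ₛ′; mk⇔)
open import Function.Properties.Inverse using (↔-refl)
open import Function.Related.Propositional using (module EquationalReasoning)
open import Relation.Binary.PropositionalEquality
  using (_≡_; _≢_; _≗_; refl; sym; trans; cong; cong₂; subst; module ≡-Reasoning)

private module Z₂ = CommutativeRing xor-∧-commutativeRing

open import Algebra.Properties.Semiring.Sum Z₂.semiring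
  using (sum-cong-≗; sum-replicate-zero; ∑-distrib-+; ∑-comm; *-distribˡ-sum; *-distribʳ-sum; sum-init-last)
  renaming (sum to ∑)
open import Algebra.Properties.CommutativeSemigroup (CommutativeMonoid.commutativeSemigroup ∧-commutativeMonoid)
  using () renaming (x∙yz≈y∙xz to ∧-swapˡ)
open import Algebra.Properties.CommutativeSemigroup +-commutativeSemigroup
  using () renaming (interchange to +-interchange; x∙yz≈y∙xz to +-swapˡ)

Σ₂≡∑ : ∀ {m} (f : Fin m → Bool) → Σ₂ f ≡ ∑ f
Σ₂≡∑ {zero} f = refl
Σ₂≡∑ {suc m} f = cong (f zero xor_) (Σ₂≡∑ (f ∘ suc))

Σ₂-cong : ∀ {m} {f g : Fin m → Bool} → f ≗ g → Σ₂ f ≡ Σ₂ g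
Σ₂-cong {f = f} {g} f≗g rewrite Σ₂≡∑ f | Σ₂≡∑ g = sum-cong-≗ f≗g

Σ₂-zero : ∀ m → Σ₂ {m} (λ _ → false) ≡ false
Σ₂-zero m rewrite Σ₂≡∑ {m} (λ _ → false) = sum-replicate-zero m

Σ₂-xor : ∀ {m} (f g : Fin m → Bool) → Σ₂ (λ i → f i xor g i) ≡ Σ₂ f xor Σ₂ g
Σ₂-xor f g rewrite Σ₂≡∑ (λ i → f i xor g i) | Σ₂≡∑ f | Σ₂≡∑ g = ∑-distrib-+ f g

Σ₂-∧ˡ : ∀ {m} c (f : Fin m → Bool) → Σ₂ (λ i → c ∧ f i) ≡ c ∧ Σ₂ f
Σ₂-∧ˡ c f rewrite Σ₂≡∑ (λ i → c ∧ f i) | Σ₂≡∑ f = sym (*-distribˡ-sum c f)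

Σ₂-∧ʳ : ∀ {m} c (f : Fin m → Bool) → Σ₂ (λ i → f i ∧ c) ≡ Σ₂ f ∧ c
Σ₂-∧ʳ c f rewrite Σ₂≡∑ (λ i → f i ∧ c) | Σ₂≡∑ f = sym (*-distribʳ-sum c f)

Σ₂-comm : ∀ {m n} (f : Fin m → Fin n → Bool) → Σ₂ (λ i → Σ₂ (f i)) ≡ Σ₂ (λ j → Σ₂ (λ i → f i j))
Σ₂-comm f = begin
  Σ₂ (λ i → Σ₂ (f i))          ≡⟨ Σ₂-cong (λ i → Σ₂≡∑ (f i)) ⟩
  Σ₂ (λ i → ∑ (f i))           ≡⟨ Σ₂≡∑ (λ i → ∑ (f i)) ⟩
  ∑ (λ i → ∑ (f i))            ≡⟨ ∑-comm f ⟩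
  ∑ (λ j → ∑ (λ i → f i j))    ≡⟨ Σ₂≡∑ (λ j → ∑ (λ i → f i j)) ⟨
  Σ₂ (λ j → ∑ (λ i → f i j))   ≡⟨ Σ₂-cong (λ j → Σ₂≡∑ (λ i → f i j)) ⟨
  Σ₂ (λ j → Σ₂ (λ i → f i j))  ∎
  where open ≡-Reasoning

Σ₂-init-last : ∀ {m} (f : Fin (suc m) → Bool) → Σ₂ f ≡ Σ₂ (f ∘ inject₁) xor f (fromℕ m)
Σ₂-init-last f rewrite Σ₂≡∑ f | Σ₂≡∑ (f ∘ inject₁) = sum-init-last f

Σ₂-opposite : ∀ {m} (f : Fin m → Bool) → Σ₂ (f ∘ opposite) ≡ Σ₂ f
Σ₂-opposite {zero} f = refl
Σ₂-opposite {suc m} f = begin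
  f (fromℕ m) xor Σ₂ (f ∘ inject₁ ∘ opposite)  ≡⟨ cong (f (fromℕ m) xor_) (Σ₂-opposite (f ∘ inject₁)) ⟩
  f (fromℕ m) xor Σ₂ (f ∘ inject₁)             ≡⟨ xor-comm (f (fromℕ m)) _ ⟩
  Σ₂ (f ∘ inject₁) xor f (fromℕ m)             ≡⟨ Σ₂-init-last f ⟨
  Σ₂ f                                         ∎
  where open ≡-Reasoning

Σ₂≡true⇒∃ : ∀ {m} (f : Fin m → Bool) → Σ₂ f ≡ true → ∃ λ k → f k ≡ true
Σ₂≡true⇒∃ {suc m} f Σf≡true with f zero in f₀≡true
... | true = zero , f₀≡true
... | false with Σ₂≡true⇒∃ (f ∘ suc) Σf≡true
...   | k , fk≡true = suc k , fk≡true

≡ᵇ-true⇒≡ : ∀ {x y} → (x ≡ᵇ y) ≡ true → x ≡ y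
≡ᵇ-true⇒≡ {x} {y} x≡ᵇy = ≡ᵇ⇒≡ x y (Equivalence.from T-≡ x≡ᵇy)

≡⇒≡ᵇ-true : ∀ {x y} → x ≡ y → (x ≡ᵇ y) ≡ true
≡⇒≡ᵇ-true {x} {y} x≡y = Equivalence.to T-≡ (≡⇒≡ᵇ x y x≡y)

≢⇒≡ᵇ-false : ∀ {x y} → x ≢ y → (x ≡ᵇ y) ≡ false
≢⇒≡ᵇ-false {x} {y} x≢y with x ≡ᵇ y in x≡ᵇy
... | true = ⊥-elim (x≢y (≡ᵇ-true⇒≡ x≡ᵇy))
... | false = refl

≡ᵇ-⇔ : ∀ {x y x′ y′} → (x ≡ y → x′ ≡ y′) → (x′ ≡ y′ → x ≡ y) → (x ≡ᵇ y) ≡ (x′ ≡ᵇ y′)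
≡ᵇ-⇔ {x} {y} {x′} {y′} to from with x ≡ᵇ y in x≡ᵇy | x′ ≡ᵇ y′ in x′≡ᵇy′
... | true | true = refl
... | false | false = refl
... | true | false = trans (sym (≡⇒≡ᵇ-true (to (≡ᵇ-true⇒≡ x≡ᵇy)))) x′≡ᵇy′
... | false | true = trans (sym x≡ᵇy) (≡⇒≡ᵇ-true (from (≡ᵇ-true⇒≡ x′≡ᵇy′)))

δ : ∀ {m} → Fin m → Fin m → Bool
δ i j = toℕ i ≡ᵇ toℕ j

Σ₂-δ : ∀ {m} (j : Fin m) (f : Fin m → Bool) → Σ₂ (λ i → δ i j ∧ f i) ≡ f j
Σ₂-δ {suc m} zero f = trans (cong (f zero xor_) (Σ₂-zero m)) (xor-identityʳ (f zero))
Σ₂-δ {suc m} (suc j) f = Σ₂-δ j (f ∘ suc)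

δ⇒≡ : ∀ {m} {i j : Fin m} → δ i j ≡ true → i ≡ j
δ⇒≡ = toℕ-injective ∘ ≡ᵇ-true⇒≡

≡⇒δ : ∀ {m} {i j : Fin m} → i ≡ j → δ i j ≡ true
≡⇒δ i≡j = ≡⇒≡ᵇ-true (cong toℕ i≡j)

δ-≢ : ∀ {m} {i j : Fin m} → i ≢ j → δ i j ≡ false
δ-≢ i≢j = ≢⇒≡ᵇ-false (i≢j ∘ toℕ-injective)

δ-sym : ∀ {m} (i j : Fin m) → δ i j ≡ δ j i
δ-sym zero zero = refl
δ-sym zero (suc j) = refl
δ-sym (suc i) zero = refl
δ-sym (suc i) (suc j) = δ-sym i j

δ-inject₁ : ∀ {m} (a b : Fin m) → δ (inject₁ a) (inject₁ b) ≡ δ a b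
δ-inject₁ a b = cong₂ _≡ᵇ_ (toℕ-inject₁ a) (toℕ-inject₁ b)

Vec₂ : ℕ → Set
Vec₂ = Vec Bool

infixl 6 _⊕ᵥ_
infixr 7 _·ᵥ_

_⊕ᵥ_ : ∀ {m} → Vec₂ m → Vec₂ m → Vec₂ m
x ⊕ᵥ y = zipWith _xor_ x y

_·ᵥ_ : ∀ {m} → Bool → Vec₂ m → Vec₂ m
c ·ᵥ x = map (c ∧_) x

lookup-⊕ᵥ : ∀ {m} (x y : Vec₂ m) i → lookup (x ⊕ᵥ y) i ≡ lookup x i xor lookup y i
lookup-⊕ᵥ x y i = lookup-zipWith _xor_ i x y

lookup-·ᵥ : ∀ {m} c (x : Vec₂ m) i → lookup (c ·ᵥ x) i ≡ c ∧ lookup x i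
lookup-·ᵥ c x i = lookup-map i (c ∧_) x

lookup-injective : ∀ {A : Set} {m} {x y : Vec A m} → lookup x ≗ lookup y → x ≡ y
lookup-injective {x = x} {y} x≗y = trans (sym (tabulate∘lookup x)) (trans (tabulate-cong x≗y) (tabulate∘lookup y))

⊕ᵥ-cancelʳ : ∀ {m} (x y : Vec₂ m) → x ⊕ᵥ y ⊕ᵥ y ≡ x
⊕ᵥ-cancelʳ x y = lookup-injective λ i → begin
  lookup (x ⊕ᵥ y ⊕ᵥ y) i                      ≡⟨ trans (lookup-⊕ᵥ (x ⊕ᵥ y) y i) (cong (_xor lookup y i) (lookup-⊕ᵥ x y i)) ⟩
  (lookup x i xor lookup y i) xor lookup y i  ≡⟨ xor-assoc (lookup x i) (lookup y i) (lookup y i) ⟩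
  lookup x i xor (lookup y i xor lookup y i)  ≡⟨ cong (lookup x i xor_) (xor-same (lookup y i)) ⟩
  lookup x i xor false                        ≡⟨ xor-identityʳ (lookup x i) ⟩
  lookup x i                                  ∎
  where open ≡-Reasoning

⊕ᵥ-cancelˡ : ∀ {m} (x y : Vec₂ m) → x ⊕ᵥ (x ⊕ᵥ y) ≡ y
⊕ᵥ-cancelˡ x y = lookup-injective λ i → begin
  lookup (x ⊕ᵥ (x ⊕ᵥ y)) i                    ≡⟨ trans (lookup-⊕ᵥ x (x ⊕ᵥ y) i) (cong (lookup x i xor_) (lookup-⊕ᵥ x y i)) ⟩
  lookup x i xor (lookup x i xor lookup y i)  ≡⟨ xor-assoc (lookup x i) (lookup x i) (lookup y i) ⟨
  (lookup x i xor lookup x i) xor lookup y i  ≡⟨ cong (_xor lookup y i) (xor-same (lookup x i)) ⟩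
  lookup y i                                  ∎
  where open ≡-Reasoning

⊕ᵥ-false· : ∀ {m} (x y : Vec₂ m) → x ⊕ᵥ false ·ᵥ y ≡ x
⊕ᵥ-false· x y = lookup-injective λ i →
  trans (lookup-⊕ᵥ x (false ·ᵥ y) i) (trans (cong (lookup x i xor_) (lookup-·ᵥ false y i)) (xor-identityʳ (lookup x i)))

true·ᵥ : ∀ {m} (y : Vec₂ m) → true ·ᵥ y ≡ y
true·ᵥ y = lookup-injective (lookup-·ᵥ true y)

ê : ∀ {m} → Fin m → Vec₂ m
ê j = tabulate (λ i → δ i j)

lookup-ê : ∀ {m} (j i : Fin m) → lookup (ê j) i ≡ δ i j
lookup-ê j i = lookup∘tabulate (λ i → δ i j) i

par : ∀ {m} → Vec₂ m → Bool
par v = Σ₂ (lookup v)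

nonzero : ∀ {m} → Vec₂ m → Bool
nonzero [] = false
nonzero (b ∷ v) = b ∨ nonzero v

lookup⇒nonzero : ∀ {m} (v : Vec₂ m) k → lookup v k ≡ true → nonzero v ≡ true
lookup⇒nonzero (true ∷ v) k _ = refl
lookup⇒nonzero (false ∷ v) (suc k) vₖ = lookup⇒nonzero v k vₖ

nonzero⇒lookup : ∀ {m} (v : Vec₂ m) → nonzero v ≡ true → ∃ λ k → lookup v k ≡ true
nonzero⇒lookup (true ∷ v) _ = zero , refl
nonzero⇒lookup (false ∷ v) nz with nonzero⇒lookup v nz
... | k , vₖ = suc k , vₖ

par⇒nonzero : ∀ {m} (v : Vec₂ m) → par v ≡ true → nonzero v ≡ true
par⇒nonzero (true ∷ v) _ = refl
par⇒nonzero (false ∷ v) odd = par⇒nonzero v odd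

infix 7 _∙_

_∙_ : ∀ {m} → Vec₂ m → (Fin m → Bool) → Bool
x ∙ f = Σ₂ (λ k → lookup x k ∧ f k)

∙-cong : ∀ {m} (x : Vec₂ m) {f g : Fin m → Bool} → f ≗ g → x ∙ f ≡ x ∙ g
∙-cong x f≗g = Σ₂-cong (λ k → cong (lookup x k ∧_) (f≗g k))

∙-⊕ᵥ : ∀ {m} (x y : Vec₂ m) f → (x ⊕ᵥ y) ∙ f ≡ x ∙ f xor y ∙ f
∙-⊕ᵥ x y f = trans (Σ₂-cong term) (Σ₂-xor (λ k → lookup x k ∧ f k) (λ k → lookup y k ∧ f k))
  where
  term : ∀ k → lookup (x ⊕ᵥ y) k ∧ f k ≡ (lookup x k ∧ f k) xor (lookup y k ∧ f k)
  term k = trans (cong (_∧ f k) (lookup-⊕ᵥ x y k)) (∧-distribʳ-xor (f k) (lookup x k) (lookup y k))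

∙-·ᵥ : ∀ {m} c (x : Vec₂ m) f → (c ·ᵥ x) ∙ f ≡ c ∧ x ∙ f
∙-·ᵥ c x f = trans (Σ₂-cong term) (Σ₂-∧ˡ c (λ k → lookup x k ∧ f k))
  where
  term : ∀ k → lookup (c ·ᵥ x) k ∧ f k ≡ c ∧ (lookup x k ∧ f k)
  term k = trans (cong (_∧ f k) (lookup-·ᵥ c x k)) (∧-assoc c (lookup x k) (f k))

∙-xor : ∀ {m} (x : Vec₂ m) f g → x ∙ (λ k → f k xor g k) ≡ x ∙ f xor x ∙ g
∙-xor x f g = trans (Σ₂-cong (λ k → ∧-distribˡ-xor (lookup x k) (f k) (g k))) (Σ₂-xor (λ k → lookup x k ∧ f k) (λ k → lookup x k ∧ g k))

∙-∧ˡ : ∀ {m} (x : Vec₂ m) c f → x ∙ (λ k → c ∧ f k) ≡ c ∧ x ∙ f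
∙-∧ˡ x c f = trans (Σ₂-cong (λ k → ∧-swapˡ (lookup x k) c (f k))) (Σ₂-∧ˡ c (λ k → lookup x k ∧ f k))

∙-∧ʳ : ∀ {m} (x : Vec₂ m) f c → x ∙ (λ k → f k ∧ c) ≡ x ∙ f ∧ c
∙-∧ʳ x f c = trans (Σ₂-cong (λ k → sym (∧-assoc (lookup x k) (f k) c))) (Σ₂-∧ʳ c (λ k → lookup x k ∧ f k))

∙-false : ∀ {m} (x : Vec₂ m) → x ∙ (λ _ → false) ≡ false
∙-false {m} x = trans (Σ₂-cong (λ k → ∧-zeroʳ (lookup x k))) (Σ₂-zero m)

∙-comm : ∀ {m n} (x : Vec₂ m) (y : Vec₂ n) (F : Fin m → Fin n → Bool) →
  x ∙ (λ k → y ∙ F k) ≡ y ∙ (λ l → x ∙ (λ k → F k l))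
∙-comm x y F = begin
  x ∙ (λ k → y ∙ F k)                                      ≡⟨ Σ₂-cong (λ k → sym (∙-∧ˡ y (lookup x k) (F k))) ⟩
  Σ₂ (λ k → Σ₂ (λ l → lookup y l ∧ (lookup x k ∧ F k l)))  ≡⟨ Σ₂-comm (λ k l → lookup y l ∧ (lookup x k ∧ F k l)) ⟩
  Σ₂ (λ l → Σ₂ (λ k → lookup y l ∧ (lookup x k ∧ F k l)))  ≡⟨ Σ₂-cong (λ l → Σ₂-∧ˡ (lookup y l) (λ k → lookup x k ∧ F k l)) ⟩
  y ∙ (λ l → x ∙ (λ k → F k l))                            ∎
  where open ≡-Reasoning

∙-ê : ∀ {m} (j : Fin m) f → ê j ∙ f ≡ f j
∙-ê j f = trans (Σ₂-cong (λ k → cong (_∧ f k) (lookup-ê j k))) (Σ₂-δ j f)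

-- The symplectic form

ω : ∀ {m} → Vec₂ m → Vec₂ m → Bool
ω x y = x ∙ (lookup y ∘ opposite)

ω-sym : ∀ {m} (x y : Vec₂ m) → ω x y ≡ ω y x
ω-sym x y = begin
  Σ₂ (λ k → lookup x k ∧ lookup y (opposite k))
    ≡⟨ Σ₂-opposite (λ k → lookup x k ∧ lookup y (opposite k)) ⟨
  Σ₂ (λ k → lookup x (opposite k) ∧ lookup y (opposite (opposite k)))
    ≡⟨ Σ₂-cong (λ k → cong (λ l → lookup x (opposite k) ∧ lookup y l) (opposite-involutive k)) ⟩
  Σ₂ (λ k → lookup x (opposite k) ∧ lookup y k)
    ≡⟨ Σ₂-cong (λ k → ∧-comm (lookup x (opposite k)) (lookup y k)) ⟩
  Σ₂ (λ k → lookup y k ∧ lookup x (opposite k)) ∎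
  where open ≡-Reasoning

ω-⊕ˡ : ∀ {m} (x y z : Vec₂ m) → ω (x ⊕ᵥ y) z ≡ ω x z xor ω y z
ω-⊕ˡ x y z = ∙-⊕ᵥ x y (lookup z ∘ opposite)

ω-·ˡ : ∀ {m} c (x z : Vec₂ m) → ω (c ·ᵥ x) z ≡ c ∧ ω x z
ω-·ˡ c x z = ∙-·ᵥ c x (lookup z ∘ opposite)

ω-⊕ʳ : ∀ {m} (x y z : Vec₂ m) → ω z (x ⊕ᵥ y) ≡ ω z x xor ω z y
ω-⊕ʳ x y z = trans (ω-sym z (x ⊕ᵥ y)) (trans (ω-⊕ˡ x y z) (cong₂ _xor_ (ω-sym x z) (ω-sym y z)))

ω-·ʳ : ∀ {m} c (x z : Vec₂ m) → ω z (c ·ᵥ x) ≡ c ∧ ω z x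
ω-·ʳ c x z = trans (ω-sym z (c ·ᵥ x)) (trans (ω-·ˡ c x z) (cong (c ∧_) (ω-sym x z)))

ω-êˡ : ∀ {m} (y : Vec₂ m) (j : Fin m) → ω (ê j) y ≡ lookup y (opposite j)
ω-êˡ y j = ∙-ê j (lookup y ∘ opposite)

ω-êʳ : ∀ {m} (x : Vec₂ m) (j : Fin m) → ω x (ê j) ≡ lookup x (opposite j)
ω-êʳ x j = trans (ω-sym x (ê j)) (ω-êˡ x j)

ω≡true⇒lookup : ∀ {m} (x y : Vec₂ m) → ω x y ≡ true → ∃ λ k → lookup x k ≡ true
ω≡true⇒lookup x y ωxy with Σ₂≡true⇒∃ (λ k → lookup x k ∧ lookup y (opposite k)) ωxy
... | k , xk∧y≡true = k , ∧-conicalˡ (lookup x k) _ xk∧y≡true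

lastᶠ : ∀ {m} → Fin (suc (suc m))
lastᶠ {m} = fromℕ (suc m)

opposite-fromℕ : ∀ m → opposite (fromℕ m) ≡ zero
opposite-fromℕ zero = refl
opposite-fromℕ (suc m) = cong inject₁ (opposite-fromℕ m)

opposite-last : ∀ {m} → opposite (lastᶠ {m}) ≡ zero
opposite-last {m} = opposite-fromℕ (suc m)

opposite-inject₁ : ∀ {m} (i : Fin m) → opposite (inject₁ i) ≡ suc (opposite i)
opposite-inject₁ {suc m} zero = refl
opposite-inject₁ {suc m} (suc i) = cong inject₁ (opposite-inject₁ i)

inner : ∀ {A : Set} {m} → Vec A (suc (suc m)) → Vec A m
inner x = tabulate (λ i → lookup x (suc (inject₁ i)))

lookup-inner : ∀ {A : Set} {m} (x : Vec A (suc (suc m))) i → lookup (inner x) i ≡ lookup x (suc (inject₁ i))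
lookup-inner x i = lookup∘tabulate (λ i → lookup x (suc (inject₁ i))) i

ω-split : ∀ {m} (x y : Vec₂ (suc (suc m))) →
  ω x y ≡ (lookup x zero ∧ lookup y lastᶠ) xor (ω (inner x) (inner y) xor (lookup x lastᶠ ∧ lookup y zero))
ω-split {m} x y = trans (cong (corner xor_) (Σ₂-init-last (λ k → lookup x (suc k) ∧ lookup y (opposite (suc k)))))
  (cong₂ (λ s t → corner xor (s xor (lookup x lastᶠ ∧ lookup y t))) (Σ₂-cong inner-term) opposite-last)
  where
  corner = lookup x zero ∧ lookup y lastᶠ
  inner-term : ∀ i → lookup x (suc (inject₁ i)) ∧ lookup y (opposite (suc (inject₁ i)))
                   ≡ lookup (inner x) i ∧ lookup (inner y) (opposite i)
  inner-term i = sym (cong₂ _∧_ (lookup-inner x i) (trans (lookup-inner y (opposite i)) (cong (lookup y) (sym (cong inject₁ (opposite-inject₁ i))))))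

Alternating : ℕ → Set
Alternating m = ∀ (x : Vec₂ m) → ω x x ≡ false

alternating : ∀ k → Alternating (k * 2)
alternating zero [] = refl
alternating (suc k) x = begin
  ω x x                                            ≡⟨ ω-split x x ⟩
  (a ∧ b) xor (ω (inner x) (inner x) xor (b ∧ a))  ≡⟨ cong (λ t → (a ∧ b) xor (t xor (b ∧ a))) (alternating k (inner x)) ⟩
  (a ∧ b) xor (b ∧ a)                              ≡⟨ cong ((a ∧ b) xor_) (∧-comm b a) ⟩
  (a ∧ b) xor (a ∧ b)                              ≡⟨ xor-same (a ∧ b) ⟩
  false                                            ∎
  where
  open ≡-Reasoning
  a = lookup x zero
  b = lookup x lastᶠ

-- Transvections

τ : ∀ {m} → Vec₂ m → Vec₂ m → Vec₂ m
τ u x = x ⊕ᵥ ω x u ·ᵥ u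

τ-fixes : ∀ {m} (u x : Vec₂ m) → ω x u ≡ false → τ u x ≡ x
τ-fixes u x ωxu≡false = trans (cong (λ c → x ⊕ᵥ c ·ᵥ u) ωxu≡false) (⊕ᵥ-false· x u)

τs : ∀ {m} → List (Vec₂ m) → Vec₂ m → Vec₂ m
τs [] x = x
τs (u ∷ us) x = τ u (τs us x)

τs⁻¹ : ∀ {m} → List (Vec₂ m) → Vec₂ m → Vec₂ m
τs⁻¹ [] x = x
τs⁻¹ (u ∷ us) x = τs⁻¹ us (τ u x)

via : ∀ {m} → Vec₂ m → Vec₂ m → Vec₂ m → List (Vec₂ m)
via x z y = z ⊕ᵥ y ∷ x ⊕ᵥ z ∷ []

τs-++ : ∀ {m} (us vs : List (Vec₂ m)) (x : Vec₂ m) → τs (us ++ vs) x ≡ τs us (τs vs x)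
τs-++ [] vs x = refl
τs-++ (u ∷ us) vs x = cong (τ u) (τs-++ us vs x)

module _ {m : ℕ} (alt : Alternating m) where

  ω-shear : ∀ {a b} (x y v : Vec₂ m) → ω x v ≡ a → ω y v ≡ b → ω (x ⊕ᵥ a ·ᵥ v) (y ⊕ᵥ b ·ᵥ v) ≡ ω x y
  ω-shear {a} {b} x y v refl refl = begin
    ω (x ⊕ᵥ a ·ᵥ v) (y ⊕ᵥ b ·ᵥ v)
      ≡⟨ trans (ω-⊕ˡ x (a ·ᵥ v) (y ⊕ᵥ b ·ᵥ v)) (cong (ω x (y ⊕ᵥ b ·ᵥ v) xor_) (ω-·ˡ a v (y ⊕ᵥ b ·ᵥ v))) ⟩
    ω x (y ⊕ᵥ b ·ᵥ v) xor (a ∧ ω v (y ⊕ᵥ b ·ᵥ v))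
      ≡⟨ cong₂ (λ s t → s xor (a ∧ t)) (trans (ω-⊕ʳ y (b ·ᵥ v) x) (cong (ω x y xor_) (ω-·ʳ b v x)))
                                         (trans (ω-⊕ʳ y (b ·ᵥ v) v) (cong₂ _xor_ (ω-sym v y) (ω-·ʳ b v v))) ⟩
    (ω x y xor (b ∧ a)) xor (a ∧ (b xor (b ∧ ω v v)))
      ≡⟨ cong (λ t → (ω x y xor (b ∧ a)) xor (a ∧ (b xor (b ∧ t)))) (alt v) ⟩
    (ω x y xor (b ∧ a)) xor (a ∧ (b xor (b ∧ false)))
      ≡⟨ cross-terms-cancel (ω x y) a b ⟩
    ω x y ∎
    where
    open ≡-Reasoning
    cross-terms-cancel : ∀ w a b → (w xor (b ∧ a)) xor (a ∧ (b xor (b ∧ false))) ≡ w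
    cross-terms-cancel false false false = refl
    cross-terms-cancel false false true = refl
    cross-terms-cancel false true false = refl
    cross-terms-cancel false true true = refl
    cross-terms-cancel true false false = refl
    cross-terms-cancel true false true = refl
    cross-terms-cancel true true false = refl
    cross-terms-cancel true true true = refl

  τ-preserves-ω : ∀ (u x y : Vec₂ m) → ω (τ u x) (τ u y) ≡ ω x y
  τ-preserves-ω u x y = ω-shear x y u refl refl

  ω-τ : ∀ (u x : Vec₂ m) → ω (τ u x) u ≡ ω x u
  ω-τ u x = trans (cong (ω (τ u x)) (sym (⊕ᵥ-false· u u)))
                  (ω-shear x u u refl (alt u))

  τ-involutive : ∀ (u x : Vec₂ m) → τ u (τ u x) ≡ x
  τ-involutive u x = trans (cong (λ c → τ u x ⊕ᵥ c ·ᵥ u) (ω-τ u x)) (⊕ᵥ-cancelʳ x (ω x u ·ᵥ u))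

  τ-moves : ∀ (x y : Vec₂ m) → ω x y ≡ true → τ (x ⊕ᵥ y) x ≡ y
  τ-moves x y ωxy≡true = begin
    x ⊕ᵥ ω x (x ⊕ᵥ y) ·ᵥ (x ⊕ᵥ y)  ≡⟨ cong (λ c → x ⊕ᵥ c ·ᵥ (x ⊕ᵥ y)) (trans (ω-⊕ʳ x y x) (cong₂ _xor_ (alt x) ωxy≡true)) ⟩
    x ⊕ᵥ true ·ᵥ (x ⊕ᵥ y)          ≡⟨ cong (x ⊕ᵥ_) (true·ᵥ (x ⊕ᵥ y)) ⟩
    x ⊕ᵥ (x ⊕ᵥ y)                  ≡⟨ ⊕ᵥ-cancelˡ x y ⟩
    y                              ∎
    where open ≡-Reasoning

  τs-via : ∀ (x z y : Vec₂ m) → ω x z ≡ true → ω z y ≡ true → τs (via x z y) x ≡ y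
  τs-via x z y ωxz ωzy = trans (cong (τ (z ⊕ᵥ y)) (τ-moves x z ωxz)) (τ-moves z y ωzy)

  τs⁻¹-τs : ∀ us (x : Vec₂ m) → τs⁻¹ us (τs us x) ≡ x
  τs⁻¹-τs [] x = refl
  τs⁻¹-τs (u ∷ us) x = trans (cong (τs⁻¹ us) (τ-involutive u (τs us x))) (τs⁻¹-τs us x)

  τs-τs⁻¹ : ∀ us (x : Vec₂ m) → τs us (τs⁻¹ us x) ≡ x
  τs-τs⁻¹ [] x = refl
  τs-τs⁻¹ (u ∷ us) x = trans (cong (τ u) (τs-τs⁻¹ us (τ u x))) (τ-involutive u x)

  τs-preserves-ω : ∀ us (x y : Vec₂ m) → ω (τs us x) (τs us y) ≡ ω x y
  τs-preserves-ω [] x y = refl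
  τs-preserves-ω (u ∷ us) x y = trans (τ-preserves-ω u (τs us x) (τs us y)) (τs-preserves-ω us x y)

  τs⁻¹-preserves-ω : ∀ us (x y : Vec₂ m) → ω (τs⁻¹ us x) (τs⁻¹ us y) ≡ ω x y
  τs⁻¹-preserves-ω [] x y = refl
  τs⁻¹-preserves-ω (u ∷ us) x y = trans (τs⁻¹-preserves-ω us (τ u x) (τ u y)) (τ-preserves-ω u x y)

-- Transitivity on hyperbolic pairs

firstOne : ∀ {m} → Vec₂ (suc m) → Fin (suc m)
firstOne {zero} _ = zero
firstOne {suc m} (b ∷ x) = if b then zero else suc (firstOne x)

firstOne-true : ∀ {m} (x : Vec₂ (suc m)) k → lookup x k ≡ true → lookup x (firstOne x) ≡ true
firstOne-true {zero} (b ∷ []) zero xk = xk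
firstOne-true {suc m} (true ∷ x) k xk = refl
firstOne-true {suc m} (false ∷ x) (suc k) xk = firstOne-true x k xk

module _ {m : ℕ} where

  ω-ê-first : (x : Vec₂ (suc (suc m))) → ω x (ê zero) ≡ lookup x lastᶠ
  ω-ê-first x = ω-êʳ x zero

  ω-ê-last : (x : Vec₂ (suc (suc m))) → ω x (ê lastᶠ) ≡ lookup x zero
  ω-ê-last x = trans (ω-êʳ x lastᶠ) (cong (lookup x) opposite-last)

  ω-first-ê : (x : Vec₂ (suc (suc m))) → ω (ê zero) x ≡ lookup x lastᶠ
  ω-first-ê x = trans (ω-sym (ê zero) x) (ω-ê-first x)

  ω-last-ê : (x : Vec₂ (suc (suc m))) → ω (ê lastᶠ) x ≡ lookup x zero
  ω-last-ê x = trans (ω-sym (ê lastᶠ) x) (ω-ê-last x)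

  ω-first-last : ω (ê zero) (ê {suc (suc m)} lastᶠ) ≡ true
  ω-first-last = trans (ω-first-ê (ê lastᶠ)) (trans (lookup-ê (lastᶠ {m}) lastᶠ) (≡⇒δ {i = lastᶠ {m}} refl))

  ω-last-first : ω (ê lastᶠ) (ê {suc (suc m)} zero) ≡ true
  ω-last-first = trans (ω-sym (ê (lastᶠ {m})) (ê zero)) ω-first-last

module _ {m : ℕ} (alt : Alternating (suc (suc m))) where

  private
    V = Vec₂ (suc (suc m))
    e₀ eₗ : V
    e₀ = ê zero
    eₗ = ê lastᶠ

  firstStage : V → List V
  firstStage e =
    if lookup e lastᶠ then e₀ ⊕ᵥ e ∷ []
    else if lookup e zero then via e₀ eₗ e
    else via e₀ (ê (opposite (firstOne e)) ⊕ᵥ eₗ) e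

  firstStage-moves : ∀ e k → lookup e k ≡ true → τs (firstStage e) e₀ ≡ e
  firstStage-moves e k ek with lookup e lastᶠ in e-last
  ... | true = τ-moves alt e₀ e (trans (ω-first-ê e) e-last)
  ... | false with lookup e zero in e-first
  ...   | true = τs-via alt e₀ eₗ e (ω-first-last {m}) (trans (ω-last-ê e) e-first)
  ...   | false = τs-via alt e₀ z e ω-first-z ω-z-e
    where
    p = firstOne e
    ep : lookup e p ≡ true
    ep = firstOne-true e k ek
    z = ê (opposite p) ⊕ᵥ eₗ
    p≢0 : p ≢ zero
    p≢0 p≡0 with trans (sym ep) (trans (cong (lookup e) p≡0) e-first)
    ... | ()
    lastᶠ≢opposite-p : lastᶠ ≢ opposite p
    lastᶠ≢opposite-p eq = p≢0 (trans (sym (opposite-involutive p)) (trans (cong opposite (sym eq)) opposite-last))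
    ω-first-z : ω e₀ z ≡ true
    ω-first-z = trans (ω-⊕ʳ (ê (opposite p)) eₗ e₀)
      (cong₂ _xor_ (trans (ω-first-ê (ê (opposite p))) (trans (lookup-ê (opposite p) lastᶠ) (δ-≢ lastᶠ≢opposite-p))) (ω-first-last {m}))
    ω-z-e : ω z e ≡ true
    ω-z-e = trans (ω-⊕ˡ (ê (opposite p)) eₗ e)
      (cong₂ _xor_ (trans (ω-êˡ e (opposite p)) (trans (cong (lookup e) (opposite-involutive p)) ep)) (trans (ω-last-ê e) e-first))

  private
    h : V
    h = e₀ ⊕ᵥ eₗ

    ω-eₗ-h : ω eₗ h ≡ true
    ω-eₗ-h = trans (ω-⊕ʳ e₀ eₗ eₗ) (cong₂ _xor_ (ω-last-first {m}) (alt eₗ))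

    ω-e₀-h : ω e₀ h ≡ true
    ω-e₀-h = trans (ω-⊕ʳ e₀ eₗ e₀) (cong₂ _xor_ (alt e₀) (ω-first-last {m}))

    τ-fixes-first : ∀ u → ω e₀ u ≡ false → τ u e₀ ≡ e₀
    τ-fixes-first u ω≡false = τ-fixes u e₀ ω≡false

  secondStage : V → List V
  secondStage f = if lookup f zero then eₗ ⊕ᵥ f ∷ [] else via eₗ h f

  secondStage-moves : ∀ f → lookup f lastᶠ ≡ true → τs (secondStage f) eₗ ≡ f
  secondStage-moves f f-last with lookup f zero in f-first
  ... | true = τ-moves alt eₗ f (trans (ω-last-ê f) f-first)
  ... | false = τs-via alt eₗ h f ω-eₗ-h
      (trans (ω-⊕ˡ e₀ eₗ f) (cong₂ _xor_ (trans (ω-first-ê f) f-last) (trans (ω-last-ê f) f-first)))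

  secondStage-fixes : ∀ f → lookup f lastᶠ ≡ true → τs (secondStage f) e₀ ≡ e₀
  secondStage-fixes f f-last with lookup f zero
  ... | true = τ-fixes-first (eₗ ⊕ᵥ f)
      (trans (ω-⊕ʳ eₗ f e₀) (cong₂ _xor_ (ω-first-last {m}) (trans (ω-first-ê f) f-last)))
  ... | false = trans (cong (τ (h ⊕ᵥ f)) (τ-fixes-first (eₗ ⊕ᵥ h)
                        (trans (ω-⊕ʳ eₗ h e₀) (cong₂ _xor_ (ω-first-last {m}) ω-e₀-h))))
                      (τ-fixes-first (h ⊕ᵥ f) (trans (ω-⊕ʳ h f e₀) (cong₂ _xor_ ω-e₀-h (trans (ω-first-ê f) f-last))))

  carry : V → V → List V
  carry e f = firstStage e ++ secondStage (τs⁻¹ (firstStage e) f)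

  module _ (e f : V) (ωef : ω e f ≡ true) where
    private
      Tₑ = firstStage e
      f′ = τs⁻¹ Tₑ f
      Tₑ-moves : τs Tₑ e₀ ≡ e
      Tₑ-moves = firstStage-moves e (proj₁ (ω≡true⇒lookup e f ωef)) (proj₂ (ω≡true⇒lookup e f ωef))
      f′-last : lookup f′ lastᶠ ≡ true
      f′-last = begin
        lookup f′ lastᶠ            ≡⟨ ω-first-ê f′ ⟨
        ω e₀ f′                    ≡⟨ cong (λ x → ω x f′) (trans (cong (τs⁻¹ Tₑ) (sym Tₑ-moves)) (τs⁻¹-τs alt Tₑ e₀)) ⟨
        ω (τs⁻¹ Tₑ e) (τs⁻¹ Tₑ f)  ≡⟨ τs⁻¹-preserves-ω alt Tₑ e f ⟩
        ω e f                      ≡⟨ ωef ⟩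
        true                       ∎
        where open ≡-Reasoning

    carry-first : τs (carry e f) e₀ ≡ e
    carry-first = trans (τs-++ Tₑ (secondStage f′) e₀) (trans (cong (τs Tₑ) (secondStage-fixes f′ f′-last)) Tₑ-moves)

    carry-last : τs (carry e f) eₗ ≡ f
    carry-last = trans (τs-++ Tₑ (secondStage f′) eₗ) (trans (cong (τs Tₑ) (secondStage-moves f′ f′-last)) (τs-τs⁻¹ alt Tₑ f))

-- Determinants

removeCol : ∀ {m} → Fin (suc m) → Vec₂ (suc m) → Vec₂ m
removeCol j x = removeAt x j

removeCol-⊕ᵥ : ∀ {m} j (x y : Vec₂ (suc m)) → removeCol j (x ⊕ᵥ y) ≡ removeCol j x ⊕ᵥ removeCol j y
removeCol-⊕ᵥ zero (x ∷ xs) (y ∷ ys) = refl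
removeCol-⊕ᵥ {suc m} (suc j) (x ∷ xs) (y ∷ ys) = cong ((x xor y) ∷_) (removeCol-⊕ᵥ j xs ys)

removeCol-·ᵥ : ∀ {m} j c (x : Vec₂ (suc m)) → removeCol j (c ·ᵥ x) ≡ c ·ᵥ removeCol j x
removeCol-·ᵥ zero c (x ∷ xs) = refl
removeCol-·ᵥ {suc m} (suc j) c (x ∷ xs) = cong ((c ∧ x) ∷_) (removeCol-·ᵥ j c xs)

det-linear-⊕ᵥ : ∀ {m} (A : Mat m) i (a b : Vec₂ m) → det (A [ i ]≔ (a ⊕ᵥ b)) ≡ det (A [ i ]≔ a) xor det (A [ i ]≔ b)
det-linear-⊕ᵥ (r ∷ rs) zero a b = ∙-⊕ᵥ a b (λ j → det (map (removeCol j) rs))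
det-linear-⊕ᵥ (r ∷ rs) (suc i) a b =
  trans (∙-cong r minor-linear) (∙-xor r (λ j → det (map (removeCol j) (rs [ i ]≔ a))) (λ j → det (map (removeCol j) (rs [ i ]≔ b))))
  where
  minor-linear : ∀ j → det (map (removeCol j) (rs [ i ]≔ (a ⊕ᵥ b)))
                     ≡ det (map (removeCol j) (rs [ i ]≔ a)) xor det (map (removeCol j) (rs [ i ]≔ b))
  minor-linear j = begin
    det (map (removeCol j) (rs [ i ]≔ (a ⊕ᵥ b)))
      ≡⟨ cong det (trans (map-[]≔ (removeCol j) rs i) (cong (map (removeCol j) rs [ i ]≔_) (removeCol-⊕ᵥ j a b))) ⟩
    det (map (removeCol j) rs [ i ]≔ (removeCol j a ⊕ᵥ removeCol j b))
      ≡⟨ det-linear-⊕ᵥ (map (removeCol j) rs) i (removeCol j a) (removeCol j b) ⟩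
    det (map (removeCol j) rs [ i ]≔ removeCol j a) xor det (map (removeCol j) rs [ i ]≔ removeCol j b)
      ≡⟨ cong₂ (λ s t → det s xor det t) (map-[]≔ (removeCol j) rs i) (map-[]≔ (removeCol j) rs i) ⟨
    det (map (removeCol j) (rs [ i ]≔ a)) xor det (map (removeCol j) (rs [ i ]≔ b)) ∎
    where open ≡-Reasoning

det-linear-·ᵥ : ∀ {m} (A : Mat m) i c (a : Vec₂ m) → det (A [ i ]≔ (c ·ᵥ a)) ≡ c ∧ det (A [ i ]≔ a)
det-linear-·ᵥ (r ∷ rs) zero c a = ∙-·ᵥ c a (λ j → det (map (removeCol j) rs))
det-linear-·ᵥ (r ∷ rs) (suc i) c a = trans (∙-cong r minor-linear) (∙-∧ˡ r c (λ j → det (map (removeCol j) (rs [ i ]≔ a))))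
  where
  minor-linear : ∀ j → det (map (removeCol j) (rs [ i ]≔ (c ·ᵥ a))) ≡ c ∧ det (map (removeCol j) (rs [ i ]≔ a))
  minor-linear j = begin
    det (map (removeCol j) (rs [ i ]≔ (c ·ᵥ a)))
      ≡⟨ cong det (trans (map-[]≔ (removeCol j) rs i) (cong (map (removeCol j) rs [ i ]≔_) (removeCol-·ᵥ j c a))) ⟩
    det (map (removeCol j) rs [ i ]≔ (c ·ᵥ removeCol j a))
      ≡⟨ det-linear-·ᵥ (map (removeCol j) rs) i c (removeCol j a) ⟩
    c ∧ det (map (removeCol j) rs [ i ]≔ removeCol j a)
      ≡⟨ cong (λ s → c ∧ det s) (map-[]≔ (removeCol j) rs i) ⟨
    c ∧ det (map (removeCol j) (rs [ i ]≔ a)) ∎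
    where open ≡-Reasoning

linComb : ∀ {p n} → Vec₂ p → Vec (Vec₂ n) p → Vec₂ n
linComb w X = tabulate (λ j → w ∙ (λ k → lookup (lookup X k) j))

lookup-linComb : ∀ {p n} (w : Vec₂ p) (X : Vec (Vec₂ n) p) j → lookup (linComb w X) j ≡ w ∙ (λ k → lookup (lookup X k) j)
lookup-linComb w X j = lookup∘tabulate (λ j → w ∙ (λ k → lookup (lookup X k) j)) j

linComb-[] : ∀ {n} (z : Vec₂ n) → linComb [] [] ≡ false ·ᵥ z
linComb-[] z = lookup-injective (λ j → trans (lookup-linComb [] [] j) (sym (lookup-·ᵥ false z j)))

linComb-∷ : ∀ {p n} w₀ (w : Vec₂ p) (x : Vec₂ n) X → linComb (w₀ ∷ w) (x ∷ X) ≡ w₀ ·ᵥ x ⊕ᵥ linComb w X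
linComb-∷ w₀ w x X = lookup-injective λ j → trans (lookup-linComb (w₀ ∷ w) (x ∷ X) j)
  (sym (trans (lookup-⊕ᵥ (w₀ ·ᵥ x) (linComb w X) j) (cong₂ _xor_ (lookup-·ᵥ w₀ x j) (lookup-linComb w X j))))

det-linComb : ∀ {m p} (A : Mat m) i (w : Vec₂ p) (X : Vec (Vec₂ m) p) →
  det (A [ i ]≔ linComb w X) ≡ w ∙ (λ k → det (A [ i ]≔ lookup X k))
det-linComb A i [] [] = trans (cong (λ x → det (A [ i ]≔ x)) (linComb-[] (linComb [] []))) (det-linear-·ᵥ A i false (linComb [] []))
det-linComb A i (w₀ ∷ w) (x ∷ X) = begin
  det (A [ i ]≔ linComb (w₀ ∷ w) (x ∷ X))                            ≡⟨ cong (λ y → det (A [ i ]≔ y)) (linComb-∷ w₀ w x X) ⟩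
  det (A [ i ]≔ (w₀ ·ᵥ x ⊕ᵥ linComb w X))                            ≡⟨ det-linear-⊕ᵥ A i (w₀ ·ᵥ x) (linComb w X) ⟩
  det (A [ i ]≔ w₀ ·ᵥ x) xor det (A [ i ]≔ linComb w X)              ≡⟨ cong₂ _xor_ (det-linear-·ᵥ A i w₀ x) (det-linComb A i w X) ⟩
  (w₀ ∧ det (A [ i ]≔ x)) xor w ∙ (λ k → det (A [ i ]≔ lookup X k))  ∎
  where open ≡-Reasoning

removeCol-zero-∷ : ∀ {n r} (ys : Vec Bool r) (ss : Vec (Vec₂ n) r) → map (removeCol zero) (zipWith _∷_ ys ss) ≡ ss
removeCol-zero-∷ [] [] = refl
removeCol-zero-∷ (y ∷ ys) (s ∷ ss) = cong (s ∷_) (removeCol-zero-∷ ys ss)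

removeCol-suc-∷ : ∀ {n r} (k : Fin (suc n)) (ys : Vec Bool r) (ss : Vec (Vec₂ (suc n)) r) →
  map (removeCol (suc k)) (zipWith _∷_ ys ss) ≡ zipWith _∷_ ys (map (removeCol k) ss)
removeCol-suc-∷ k [] [] = refl
removeCol-suc-∷ k (y ∷ ys) (s ∷ ss) = cong ((y ∷ removeCol k s) ∷_) (removeCol-suc-∷ k ys ss)

columns-split : ∀ {n r} (M : Vec (Vec₂ (suc n)) r) → M ≡ zipWith _∷_ (map head M) (map (removeCol zero) M)
columns-split [] = refl
columns-split ((x ∷ v) ∷ M) = cong ((x ∷ v) ∷_) (columns-split M)

-- Laplace expansion of det (a ∷ a ∷ M) along its first two rows, with det replaced by an arbitrary F
doubleExpansion : ∀ {n r} → (Vec (Vec₂ n) r → Bool) → Vec₂ (suc (suc n)) → Vec (Vec₂ (suc (suc n))) r → Bool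
doubleExpansion F a M = a ∙ (λ k → removeCol k a ∙ (λ l → F (map (removeCol l) (map (removeCol k) M))))

-- Each pair of columns {k, l} occurs twice, once in each order; peeling off the first column makes this an induction.
doubleExpansion≡false : ∀ n {r} F (a : Vec₂ (suc (suc n))) (M : Vec (Vec₂ (suc (suc n))) r) → doubleExpansion F a M ≡ false
doubleExpansion≡false zero F (x ∷ y ∷ []) M =
  trans (cong₂ (λ A B → (x ∧ ((y ∧ F A) xor false)) xor ((y ∧ ((x ∧ F B) xor false)) xor false)) (empty-rows _) (empty-rows _))
        (pair-cancels x y (F (replicate _ [])))
  where
  empty-rows : ∀ {r} (A : Vec (Vec₂ 0) r) → A ≡ replicate r []
  empty-rows [] = refl
  empty-rows ([] ∷ A) = cong ([] ∷_) (empty-rows A)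
  pair-cancels : ∀ x y c → (x ∧ ((y ∧ c) xor false)) xor ((y ∧ ((x ∧ c) xor false)) xor false) ≡ false
  pair-cancels false y c = trans (xor-identityʳ (y ∧ false)) (∧-zeroʳ y)
  pair-cancels true false c = refl
  pair-cancels true true c = trans (cong (λ t → t xor (t xor false)) (xor-identityʳ c)) (trans (cong (c xor_) (xor-identityʳ c)) (xor-same c))
doubleExpansion≡false (suc n) F (x ∷ a) M = subst (λ M → doubleExpansion F (x ∷ a) M ≡ false) (sym (columns-split M))
  (split-first-column (map head M) (map (removeCol zero) M))
  where
  split-first-column : ∀ ys ss → doubleExpansion F (x ∷ a) (zipWith _∷_ ys ss) ≡ false
  split-first-column ys ss = begin
    doubleExpansion F (x ∷ a) (zipWith _∷_ ys ss)
      ≡⟨ cong₂ _xor_ (cong (x ∧_) (∙-cong a (λ l → cong (F ∘ map (removeCol l)) (removeCol-zero-∷ ys ss)))) (∙-cong a first-column) ⟩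
    (x ∧ a ∙ G) xor a ∙ (λ k → (x ∧ G k) xor H k)
      ≡⟨ cong ((x ∧ a ∙ G) xor_) (trans (∙-xor a (λ k → x ∧ G k) H) (cong₂ _xor_ (∙-∧ˡ a x G) (doubleExpansion≡false n F′ a ss))) ⟩
    (x ∧ a ∙ G) xor ((x ∧ a ∙ G) xor false)
      ≡⟨ trans (cong ((x ∧ a ∙ G) xor_) (xor-identityʳ (x ∧ a ∙ G))) (xor-same (x ∧ a ∙ G)) ⟩
    false ∎
    where
    open ≡-Reasoning
    F′ : Vec (Vec₂ n) _ → Bool
    F′ v = F (zipWith _∷_ ys v)
    G : Fin (suc (suc n)) → Bool
    G k = F (map (removeCol k) ss)
    H : Fin (suc (suc n)) → Bool
    H k = removeCol k a ∙ (λ l → F′ (map (removeCol l) (map (removeCol k) ss)))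
    first-column : ∀ k → (x ∷ removeCol k a) ∙ (λ l → F (map (removeCol l) (map (removeCol (suc k)) (zipWith _∷_ ys ss))))
                       ≡ (x ∧ G k) xor H k
    first-column k = cong₂ (λ s t → (x ∧ F s) xor t)
      (trans (cong (map (removeCol zero)) (removeCol-suc-∷ k ys ss)) (removeCol-zero-∷ ys (map (removeCol k) ss)))
      (∙-cong (removeCol k a) (λ l → cong F (trans (cong (map (removeCol (suc l))) (removeCol-suc-∷ k ys ss))
                                                   (removeCol-suc-∷ l ys (map (removeCol k) ss)))))

det-equal-head-rows : ∀ {n} (r : Vec₂ (suc (suc n))) (rs : Vec (Vec₂ (suc (suc n))) n) → det (r ∷ r ∷ rs) ≡ false
det-equal-head-rows {n} r rs = doubleExpansion≡false n det r rs

DetAlternating : ℕ → Set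
DetAlternating m = ∀ (X : Mat m) {p q} → p ≢ q → lookup X p ≡ lookup X q → det X ≡ false

det-swap : ∀ {m} → DetAlternating m → (X : Mat m) {p q : Fin m} → p ≢ q →
  det ((X [ p ]≔ lookup X q) [ q ]≔ lookup X p) ≡ det X
det-swap {m} alt X {p} {q} p≢q = sym (begin
  det X  ≡⟨ cong det (trans (cong (_[ q ]≔ y) ([]≔-lookup X p)) ([]≔-lookup X q)) ⟨
  D x y  ≡⟨ xor-≡false (D x y) (D y x) D-antisymmetric ⟩
  D y x  ∎)
  where
  open ≡-Reasoning
  x = lookup X p
  y = lookup X q
  D : Vec₂ m → Vec₂ m → Bool
  D a b = det ((X [ p ]≔ a) [ q ]≔ b)
  D-diagonal : ∀ z → D z z ≡ false
  D-diagonal z = alt ((X [ p ]≔ z) [ q ]≔ z) p≢q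
    (trans (lookup∘update′ p≢q (X [ p ]≔ z) z) (trans (lookup∘update p X z) (sym (lookup∘update q (X [ p ]≔ z) z))))
  D-linearˡ : ∀ a b w → D (a ⊕ᵥ b) w ≡ D a w xor D b w
  D-linearˡ a b w = begin
    det ((X [ p ]≔ (a ⊕ᵥ b)) [ q ]≔ w)
      ≡⟨ cong det ([]≔-commutes X p q p≢q) ⟩
    det ((X [ q ]≔ w) [ p ]≔ (a ⊕ᵥ b))
      ≡⟨ det-linear-⊕ᵥ (X [ q ]≔ w) p a b ⟩
    det ((X [ q ]≔ w) [ p ]≔ a) xor det ((X [ q ]≔ w) [ p ]≔ b)
      ≡⟨ cong₂ (λ s t → det s xor det t) ([]≔-commutes X p q p≢q) ([]≔-commutes X p q p≢q) ⟨
    D a w xor D b w ∎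
  D-linearʳ : ∀ a b w → D w (a ⊕ᵥ b) ≡ D w a xor D w b
  D-linearʳ a b w = det-linear-⊕ᵥ (X [ p ]≔ w) q a b
  D-antisymmetric : D x y xor D y x ≡ false
  D-antisymmetric = begin
    D x y xor D y x                          ≡⟨ cong (D x y xor_) (xor-identityʳ (D y x)) ⟨
    (false xor D x y) xor (D y x xor false)  ≡⟨ cong₂ (λ s t → (s xor D x y) xor (D y x xor t)) (D-diagonal x) (D-diagonal y) ⟨
    (D x x xor D x y) xor (D y x xor D y y)  ≡⟨ cong₂ _xor_ (D-linearʳ x y x) (D-linearʳ x y y) ⟨
    D x (x ⊕ᵥ y) xor D y (x ⊕ᵥ y)            ≡⟨ D-linearˡ x y (x ⊕ᵥ y) ⟨
    D (x ⊕ᵥ y) (x ⊕ᵥ y)                      ≡⟨ D-diagonal (x ⊕ᵥ y) ⟩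
    false                                    ∎
  xor-≡false : ∀ a b → a xor b ≡ false → a ≡ b
  xor-≡false false false _ = refl
  xor-≡false true true _ = refl

det-repeated-head : ∀ {m} → DetAlternating m → (r : Vec₂ (suc m)) (rs : Vec (Vec₂ (suc m)) m) (q : Fin m) →
  lookup rs q ≡ r → det (r ∷ rs) ≡ false
det-repeated-head alt r (.r ∷ rs) zero refl = det-equal-head-rows r rs
det-repeated-head alt r (r′ ∷ rs) (suc q) rs[q]≡r =
  trans (∙-cong r swap-in-minor) (det-equal-head-rows r (rs [ q ]≔ r′))
  where
  -- exchanging rows 0 and q + 1 of each minor brings the repeated row next to the first one
  swap-in-minor : ∀ k → det (map (removeCol k) (r′ ∷ rs)) ≡ det (map (removeCol k) (r ∷ rs [ q ]≔ r′))
  swap-in-minor k = trans (sym (det-swap alt (map (removeCol k) (r′ ∷ rs)) {zero} {suc q} (λ ())))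
    (cong₂ (λ s t → det (s ∷ t)) (trans (lookup-map q (removeCol k) rs) (cong (removeCol k) rs[q]≡r))
                                 (sym (map-[]≔ (removeCol k) rs q)))

det-alternating : ∀ m → DetAlternating m
det-alternating (suc m) (r ∷ rs) {zero} {zero} 0≢0 _ = ⊥-elim (0≢0 refl)
det-alternating (suc m) (r ∷ rs) {zero} {suc q} _ r≡rs[q] = det-repeated-head (det-alternating m) r rs q (sym r≡rs[q])
det-alternating (suc m) (r ∷ rs) {suc p} {zero} _ rs[p]≡r = det-repeated-head (det-alternating m) r rs p rs[p]≡r
det-alternating (suc m) (r ∷ rs) {suc p} {suc q} p≢q rs[p]≡rs[q] = trans (∙-cong r minor-vanishes) (∙-false r)
  where
  minor-vanishes : ∀ j → det (map (removeCol j) rs) ≡ false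
  minor-vanishes j = det-alternating m (map (removeCol j) rs) (p≢q ∘ cong suc)
    (trans (lookup-map p (removeCol j) rs) (trans (cong (removeCol j) rs[p]≡rs[q]) (sym (lookup-map q (removeCol j) rs))))

addRows : ∀ {n p} → Vec (Vec₂ n) p → Vec₂ p → Vec₂ n → Vec (Vec₂ n) p
addRows X u r = zipWith (λ uᵢ x → x ⊕ᵥ uᵢ ·ᵥ r) u X

removeCol-addRows : ∀ {m p} (j : Fin (suc m)) (X : Vec (Vec₂ (suc m)) p) (u : Vec₂ p) r →
  map (removeCol j) (addRows X u r) ≡ addRows (map (removeCol j) X) u (removeCol j r)
removeCol-addRows j [] [] r = refl
removeCol-addRows j (x ∷ X) (u₀ ∷ u) r =
  cong₂ _∷_ (trans (removeCol-⊕ᵥ j x (u₀ ·ᵥ r)) (cong (removeCol j x ⊕ᵥ_) (removeCol-·ᵥ j u₀ r))) (removeCol-addRows j X u r)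

-- Multilinearity in all rows at once; the terms with two or more rows replaced by r vanish.
det-addRows : ∀ {m} (X : Mat m) (u r : Vec₂ m) → det (addRows X u r) ≡ det X xor u ∙ (λ i → det (X [ i ]≔ r))
det-addRows {zero} [] [] [] = refl
det-addRows {suc m} (x ∷ X) (u₀ ∷ u) r = begin
  (x ⊕ᵥ u₀ ·ᵥ r) ∙ (λ j → det (map (removeCol j) (addRows X u r)))
    ≡⟨ ∙-cong (x ⊕ᵥ u₀ ·ᵥ r) expand-minor ⟩
  (x ⊕ᵥ u₀ ·ᵥ r) ∙ (λ j → D j xor E j)
    ≡⟨ trans (∙-⊕ᵥ x (u₀ ·ᵥ r) D⊕E) (cong (x ∙ D⊕E xor_) (∙-·ᵥ u₀ r D⊕E)) ⟩
  x ∙ (λ j → D j xor E j) xor (u₀ ∧ r ∙ (λ j → D j xor E j))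
    ≡⟨ cong₂ (λ s t → s xor (u₀ ∧ t)) (∙-xor x D E) (∙-xor r D E) ⟩
  (det (x ∷ X) xor x ∙ E) xor (u₀ ∧ (det (r ∷ X) xor r ∙ E))
    ≡⟨ cong₂ (λ s t → (det (x ∷ X) xor s) xor (u₀ ∧ (det (r ∷ X) xor t))) (∙-comm x u F) r∙E≡false ⟩
  (det (x ∷ X) xor S) xor (u₀ ∧ (det (r ∷ X) xor false))
    ≡⟨ cong (λ t → (det (x ∷ X) xor S) xor (u₀ ∧ t)) (xor-identityʳ (det (r ∷ X))) ⟩
  (det (x ∷ X) xor S) xor (u₀ ∧ det (r ∷ X))
    ≡⟨ xor-assoc (det (x ∷ X)) S _ ⟩
  det (x ∷ X) xor (S xor (u₀ ∧ det (r ∷ X)))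
    ≡⟨ cong (det (x ∷ X) xor_) (xor-comm S _) ⟩
  det (x ∷ X) xor ((u₀ ∧ det (r ∷ X)) xor S) ∎
  where
  open ≡-Reasoning
  F : Fin (suc m) → Fin m → Bool
  F j i = det (map (removeCol j) (X [ i ]≔ r))
  D E : Fin (suc m) → Bool
  D j = det (map (removeCol j) X)
  E j = u ∙ F j
  D⊕E : Fin (suc m) → Bool
  D⊕E j = D j xor E j
  S = u ∙ (λ i → det (x ∷ X [ i ]≔ r))
  expand-minor : ∀ j → det (map (removeCol j) (addRows X u r)) ≡ D j xor E j
  expand-minor j = begin
    det (map (removeCol j) (addRows X u r))
      ≡⟨ cong det (removeCol-addRows j X u r) ⟩
    det (addRows (map (removeCol j) X) u (removeCol j r))
      ≡⟨ det-addRows (map (removeCol j) X) u (removeCol j r) ⟩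
    D j xor u ∙ (λ i → det (map (removeCol j) X [ i ]≔ removeCol j r))
      ≡⟨ cong (D j xor_) (∙-cong u (λ i → cong det (map-[]≔ (removeCol j) X i))) ⟨
    D j xor E j ∎
  r∙E≡false : r ∙ E ≡ false
  r∙E≡false = trans (∙-comm r u F) (trans (∙-cong u (λ i → det-alternating (suc m) (r ∷ X [ i ]≔ r) {zero} {suc i} (λ ())
                                                               (sym (lookup∘update i X r))))
                                           (∙-false u))

det-addRows-linComb : ∀ {m} (X : Mat m) (u w : Vec₂ m) → u ∙ lookup w ≡ false → det (addRows X u (linComb w X)) ≡ det X
det-addRows-linComb {m} X u w u∙w≡false = begin
  det (addRows X u (linComb w X))                              ≡⟨ det-addRows X u (linComb w X) ⟩
  det X xor u ∙ (λ i → det (X [ i ]≔ linComb w X))             ≡⟨ cong (det X xor_) (∙-cong u (λ i → det-linComb X i w X)) ⟩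
  det X xor u ∙ (λ i → w ∙ (λ k → det (X [ i ]≔ lookup X k)))  ≡⟨ cong (det X xor_) (∙-cong u replaced-row) ⟩
  det X xor u ∙ (λ i → lookup w i ∧ det X)                     ≡⟨ cong (det X xor_) (∙-∧ʳ u (lookup w) (det X)) ⟩
  det X xor (u ∙ lookup w ∧ det X)                             ≡⟨ cong (λ t → det X xor (t ∧ det X)) u∙w≡false ⟩
  det X xor false                                              ≡⟨ xor-identityʳ (det X) ⟩
  det X                                                        ∎
  where
  open ≡-Reasoning
  row-copy : ∀ i k → det (X [ i ]≔ lookup X k) ≡ δ k i ∧ det X
  row-copy i k with δ k i in δki
  ... | true = trans (cong (λ l → det (X [ i ]≔ lookup X l)) (δ⇒≡ δki)) (cong det ([]≔-lookup X i))
  ... | false = det-alternating m (X [ i ]≔ lookup X k) {i} {k} i≢k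
                  (trans (lookup∘update i X (lookup X k)) (sym (lookup∘update′ (i≢k ∘ sym) X (lookup X k))))
    where
    i≢k : i ≢ k
    i≢k refl with trans (sym δki) (≡⇒δ {i = i} refl)
    ... | ()
  replaced-row : ∀ i → w ∙ (λ k → det (X [ i ]≔ lookup X k)) ≡ lookup w i ∧ det X
  replaced-row i = begin
    w ∙ (λ k → det (X [ i ]≔ lookup X k))    ≡⟨ ∙-cong w (row-copy i) ⟩
    Σ₂ (λ k → lookup w k ∧ (δ k i ∧ det X))  ≡⟨ Σ₂-cong (λ k → ∧-swapˡ (lookup w k) (δ k i) (det X)) ⟩
    Σ₂ (λ k → δ k i ∧ (lookup w k ∧ det X))  ≡⟨ Σ₂-δ i (λ k → lookup w k ∧ det X) ⟩
    lookup w i ∧ det X                       ∎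

entry-injective : ∀ {m} {A B : Mat m} → (∀ i j → entry A i j ≡ entry B i j) → A ≡ B
entry-injective A≗B = lookup-injective (λ i → lookup-injective (A≗B i))

entry-tabulate : ∀ {m} (F : Fin m → Fin m → Bool) i j → entry (tabulate (λ i → tabulate (F i))) i j ≡ F i j
entry-tabulate F i j = trans (cong (λ r → lookup r j) (lookup∘tabulate (λ i → tabulate (F i)) i)) (lookup∘tabulate (F i) j)

entry-≡tabulate : ∀ {m} {F : Fin m → Fin m → Bool} (X : Mat m) → X ≡ tabulate (λ i → tabulate (F i)) → ∀ i j → entry X i j ≡ F i j
entry-≡tabulate {F = F} _ refl = entry-tabulate F

entry-transpose : ∀ {m} (A : Mat m) i j → entry (transpose A) i j ≡ entry A j i
entry-transpose A = entry-tabulate (λ i j → entry A j i)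

transpose-involutive : ∀ {m} (A : Mat m) → transpose (transpose A) ≡ A
transpose-involutive A = entry-injective (λ i j → trans (entry-transpose (transpose A) i j) (entry-transpose A j i))

reflect : ∀ {m} → Vec₂ m → Vec₂ m
reflect u = tabulate (lookup u ∘ opposite)

lookup-reflect : ∀ {m} (u : Vec₂ m) k → lookup (reflect u) k ≡ lookup u (opposite k)
lookup-reflect u k = lookup∘tabulate (lookup u ∘ opposite) k

transpose-map-τ : ∀ {m} (u : Vec₂ m) (C : Mat m) → transpose (map (τ u) C) ≡ addRows (transpose C) u (linComb (reflect u) (transpose C))
transpose-map-τ u C = entry-injective λ i j → begin
  entry (transpose (map (τ u) C)) i j
    ≡⟨ trans (entry-transpose (map (τ u) C) i j) (cong (λ r → lookup r i) (lookup-map j (τ u) C)) ⟩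
  lookup (τ u (lookup C j)) i
    ≡⟨ trans (lookup-⊕ᵥ (lookup C j) _ i) (cong (entry C j i xor_) (lookup-·ᵥ (ω (lookup C j) u) u i)) ⟩
  entry C j i xor (ω (lookup C j) u ∧ lookup u i)
    ≡⟨ cong₂ _xor_ (sym (entry-transpose C i j)) (trans (∧-comm _ (lookup u i)) (cong (lookup u i ∧_) (sym (r-entry j)))) ⟩
  entry (transpose C) i j xor (lookup u i ∧ lookup r j)
    ≡⟨ cong (entry (transpose C) i j xor_) (lookup-·ᵥ (lookup u i) r j) ⟨
  entry (transpose C) i j xor lookup (lookup u i ·ᵥ r) j
    ≡⟨ lookup-⊕ᵥ (lookup (transpose C) i) (lookup u i ·ᵥ r) j ⟨
  lookup (lookup (transpose C) i ⊕ᵥ lookup u i ·ᵥ r) j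
    ≡⟨ cong (λ row → lookup row j) (lookup-zipWith (λ uᵢ x → x ⊕ᵥ uᵢ ·ᵥ r) i u (transpose C)) ⟨
  entry (addRows (transpose C) u r) i j ∎
  where
  open ≡-Reasoning
  r = linComb (reflect u) (transpose C)
  r-entry : ∀ j → lookup r j ≡ ω (lookup C j) u
  r-entry j = trans (lookup-linComb (reflect u) (transpose C) j) (Σ₂-cong λ k →
    trans (cong₂ _∧_ (lookup-reflect u k) (entry-transpose C k j)) (∧-comm (lookup u (opposite k)) (entry C j k)))

module _ {m : ℕ} (alt : Alternating m) where

  det-transpose-τ : ∀ u (C : Mat m) → det (transpose (map (τ u) C)) ≡ det (transpose C)
  det-transpose-τ u C = trans (cong det (transpose-map-τ u C))
    (det-addRows-linComb (transpose C) u (reflect u) (trans (∙-cong u (lookup-reflect u)) (alt u)))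

  det-transpose-τs : ∀ us (C : Mat m) → det (transpose (map (τs us) C)) ≡ det (transpose C)
  det-transpose-τs [] C = cong (det ∘ transpose) (map-id C)
  det-transpose-τs (u ∷ us) C = begin
    det (transpose (map (τs (u ∷ us)) C))        ≡⟨ cong (det ∘ transpose) (map-∘ (τ u) (τs us) C) ⟩
    det (transpose (map (τ u) (map (τs us) C)))  ≡⟨ det-transpose-τ u (map (τs us) C) ⟩
    det (transpose (map (τs us) C))              ≡⟨ det-transpose-τs us C ⟩
    det (transpose C)                            ∎
    where open ≡-Reasoning

-- Bordering by the standard hyperbolic pair

data Position {m : ℕ} : Fin (suc (suc m)) → Set where
  first : Position zero
  middle : (i : Fin m) → Position (suc (inject₁ i))
  last : Position lastᶠ

position : ∀ {m} (k : Fin (suc (suc m))) → Position k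
position zero = first
position {zero} (suc zero) = last
position {suc m} (suc k) with position k
... | first = middle zero
... | middle i = middle (suc i)
... | last = last

lookup-∷ʳ-inject₁ : ∀ {A : Set} {m} (v : Vec A m) (b : A) (j : Fin m) → lookup (v ∷ʳ b) (inject₁ j) ≡ lookup v j
lookup-∷ʳ-inject₁ (x ∷ v) b zero = refl
lookup-∷ʳ-inject₁ (x ∷ v) b (suc j) = lookup-∷ʳ-inject₁ v b j

lookup-∷ʳ-fromℕ : ∀ {A : Set} {m} (v : Vec A m) (b : A) → lookup (v ∷ʳ b) (fromℕ m) ≡ b
lookup-∷ʳ-fromℕ [] b = refl
lookup-∷ʳ-fromℕ (x ∷ v) b = lookup-∷ʳ-fromℕ v b

padᵥ : ∀ {m} → Vec₂ m → Vec₂ (suc (suc m))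
padᵥ x = false ∷ (x ∷ʳ false)

padᵥ-middle : ∀ {m} (x : Vec₂ m) i → lookup (padᵥ x) (suc (inject₁ i)) ≡ lookup x i
padᵥ-middle x i = lookup-∷ʳ-inject₁ x false i

padᵥ-last : ∀ {m} (x : Vec₂ m) → lookup (padᵥ x) lastᶠ ≡ false
padᵥ-last x = lookup-∷ʳ-fromℕ x false

inner-padᵥ : ∀ {m} (x : Vec₂ m) → inner (padᵥ x) ≡ x
inner-padᵥ x = lookup-injective (λ i → trans (lookup-inner (padᵥ x) i) (padᵥ-middle x i))

padᵥ-inner : ∀ {m} (x : Vec₂ (suc (suc m))) → lookup x zero ≡ false → lookup x lastᶠ ≡ false → padᵥ (inner x) ≡ x
padᵥ-inner x x₀ xₗ = lookup-injective (λ k → at (position k))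
  where
  at : ∀ {k} → Position k → lookup (padᵥ (inner x)) k ≡ lookup x k
  at first = sym x₀
  at (middle i) = trans (padᵥ-middle (inner x) i) (lookup-inner x i)
  at last = trans (padᵥ-last (inner x)) (sym xₗ)

ω-padᵥ : ∀ {m} (x y : Vec₂ m) → ω (padᵥ x) (padᵥ y) ≡ ω x y
ω-padᵥ x y = trans (ω-split (padᵥ x) (padᵥ y))
  (trans (cong (λ t → ω (inner (padᵥ x)) (inner (padᵥ y)) xor (t ∧ false)) (padᵥ-last x))
  (trans (xor-identityʳ _) (cong₂ ω (inner-padᵥ x) (inner-padᵥ y))))

padM : ∀ {m} → Mat m → Mat (suc (suc m))
padM B = ê zero ∷ (map padᵥ B ∷ʳ ê lastᶠ)

unpadM : ∀ {m} → Mat (suc (suc m)) → Mat m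
unpadM X = map inner (inner X)

padRow : ∀ {m} → Mat m → {k : Fin (suc (suc m))} → Position k → Vec₂ (suc (suc m))
padRow B first = ê zero
padRow B (middle i) = padᵥ (lookup B i)
padRow B last = ê lastᶠ

padM-middle : ∀ {m} (B : Mat m) i → lookup (padM B) (suc (inject₁ i)) ≡ padᵥ (lookup B i)
padM-middle B i = trans (lookup-∷ʳ-inject₁ (map padᵥ B) (ê lastᶠ) i) (lookup-map i padᵥ B)

padM-last : ∀ {m} (B : Mat m) → lookup (padM B) lastᶠ ≡ ê lastᶠ
padM-last B = lookup-∷ʳ-fromℕ (map padᵥ B) (ê lastᶠ)

lookup-padM : ∀ {m} (B : Mat m) k → lookup (padM B) k ≡ padRow B (position k)
lookup-padM B k with position k
... | first = refl
... | middle i = padM-middle B i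
... | last = padM-last B

lookup-unpadM : ∀ {m} (X : Mat (suc (suc m))) i → lookup (unpadM X) i ≡ inner (lookup X (suc (inject₁ i)))
lookup-unpadM X i = trans (lookup-map i inner (inner X)) (cong inner (lookup-inner X i))

unpadM-padM : ∀ {m} (B : Mat m) → unpadM (padM B) ≡ B
unpadM-padM B = lookup-injective λ i → trans (lookup-unpadM (padM B) i)
  (trans (cong inner (padM-middle B i)) (inner-padᵥ (lookup B i)))

padEntry : ∀ {m} → Mat m → {k l : Fin (suc (suc m))} → Position k → Position l → Bool
padEntry B first first = true
padEntry B (middle i) (middle j) = entry B i j
padEntry B last last = true
padEntry B _ _ = false

entry-padM : ∀ {m} (B : Mat m) k l → entry (padM B) k l ≡ padEntry B (position k) (position l)
entry-padM {m} B k l = trans (cong (λ r → lookup r l) (lookup-padM B k)) (row-entry (position k) (position l))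
  where
  row-entry : ∀ {k l} (pk : Position k) (pl : Position l) → lookup (padRow B pk) l ≡ padEntry B pk pl
  row-entry first first = refl
  row-entry first (middle j) = lookup-ê zero (suc (inject₁ j))
  row-entry first last = lookup-ê zero (lastᶠ {m})
  row-entry (middle i) first = refl
  row-entry (middle i) (middle j) = padᵥ-middle (lookup B i) j
  row-entry (middle i) last = padᵥ-last (lookup B i)
  row-entry last first = lookup-ê (lastᶠ {m}) zero
  row-entry last (middle j) = trans (lookup-ê (lastᶠ {m}) (suc (inject₁ j))) (δ-≢ {i = suc (inject₁ j)} {lastᶠ} (fromℕ≢inject₁ ∘ sym ∘ suc-injective))
  row-entry last last = trans (lookup-ê (lastᶠ {m}) lastᶠ) (≡⇒δ {i = lastᶠ {m}} refl)

padEntry-transpose : ∀ {m} (B : Mat m) {k l} (pk : Position k) (pl : Position l) → padEntry B pk pl ≡ padEntry (transpose B) pl pk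
padEntry-transpose B first first = refl
padEntry-transpose B first (middle j) = refl
padEntry-transpose B first last = refl
padEntry-transpose B (middle i) first = refl
padEntry-transpose B (middle i) (middle j) = sym (entry-transpose B j i)
padEntry-transpose B (middle i) last = refl
padEntry-transpose B last first = refl
padEntry-transpose B last (middle j) = refl
padEntry-transpose B last last = refl

transpose-padM : ∀ {m} (B : Mat m) → transpose (padM B) ≡ padM (transpose B)
transpose-padM B = entry-injective λ k l → begin
  entry (transpose (padM B)) k l                    ≡⟨ entry-transpose (padM B) k l ⟩
  entry (padM B) l k                                ≡⟨ entry-padM B l k ⟩
  padEntry B (position l) (position k)              ≡⟨ padEntry-transpose B (position l) (position k) ⟩
  padEntry (transpose B) (position k) (position l)  ≡⟨ entry-padM (transpose B) k l ⟨
  entry (padM (transpose B)) k l                    ∎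
  where open ≡-Reasoning

-- diag(X, 1)
extend : ∀ {n p} → Vec (Vec₂ n) p → Vec (Vec₂ (suc n)) (suc p)
extend {n} X = map (_∷ʳ false) X ∷ʳ (replicate n false ∷ʳ true)

removeAt-∷ʳ : ∀ {A : Set} {m} (v : Vec A (suc m)) (b : A) (j : Fin (suc m)) → removeAt (v ∷ʳ b) (inject₁ j) ≡ removeAt v j ∷ʳ b
removeAt-∷ʳ (x ∷ v) b zero = refl
removeAt-∷ʳ {m = suc m} (x ∷ v) b (suc j) = cong (x ∷_) (removeAt-∷ʳ v b j)

removeAt-replicate : ∀ {A : Set} m (x : A) (j : Fin (suc m)) → removeAt (replicate (suc m) x) j ≡ replicate m x
removeAt-replicate m x zero = refl
removeAt-replicate (suc m) x (suc j) = cong (x ∷_) (removeAt-replicate m x j)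

removeCol-extend : ∀ {n p} (X : Vec (Vec₂ (suc n)) p) j → map (removeCol (inject₁ j)) (extend X) ≡ extend (map (removeCol j) X)
removeCol-extend {n} X j = trans (map-∷ʳ (removeCol (inject₁ j)) (replicate (suc n) false ∷ʳ true) (map (_∷ʳ false) X))
  (cong₂ _∷ʳ_ (trans (sym (map-∘ (removeCol (inject₁ j)) (_∷ʳ false) X))
                     (trans (map-cong (λ v → removeAt-∷ʳ v false j) X) (map-∘ (_∷ʳ false) (removeCol j) X)))
              (trans (removeAt-∷ʳ (replicate (suc n) false) true j) (cong (_∷ʳ true) (removeAt-replicate n false j))))

det-extend : ∀ {m} (X : Mat m) → det (extend X) ≡ det X
det-extend {zero} [] = refl
det-extend {suc m} (x ∷ X) = begin
  (x ∷ʳ false) ∙ (λ j → det (map (removeCol j) (extend X)))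
    ≡⟨ Σ₂-init-last (λ j → lookup (x ∷ʳ false) j ∧ det (map (removeCol j) (extend X))) ⟩
  Σ₂ (λ j → lookup (x ∷ʳ false) (inject₁ j) ∧ det (map (removeCol (inject₁ j)) (extend X)))
    xor (lookup (x ∷ʳ false) (fromℕ (suc m)) ∧ det (map (removeCol (fromℕ (suc m))) (extend X)))
    ≡⟨ cong₂ _xor_ (Σ₂-cong (λ j → cong₂ _∧_ (lookup-∷ʳ-inject₁ x false j)
                                              (trans (cong det (removeCol-extend X j)) (det-extend (map (removeCol j) X)))))
                   (cong (_∧ det (map (removeCol (fromℕ (suc m))) (extend X))) (lookup-∷ʳ-fromℕ x false)) ⟩
  det (x ∷ X) xor false
    ≡⟨ xor-identityʳ (det (x ∷ X)) ⟩
  det (x ∷ X) ∎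
  where open ≡-Reasoning

ê-fromℕ : ∀ m → ê (fromℕ m) ≡ replicate m false ∷ʳ true
ê-fromℕ zero = refl
ê-fromℕ (suc m) = cong (false ∷_) (ê-fromℕ m)

det-padM : ∀ {m} (B : Mat m) → det (padM B) ≡ det B
det-padM {m} B = begin
  ê zero ∙ (λ j → det (map (removeCol j) (map padᵥ B ∷ʳ ê lastᶠ)))  ≡⟨ ∙-ê zero (λ j → det (map (removeCol j) (map padᵥ B ∷ʳ ê lastᶠ))) ⟩
  det (map (removeCol zero) (map padᵥ B ∷ʳ ê lastᶠ))                ≡⟨ cong det first-minor ⟩
  det (extend B)                                                    ≡⟨ det-extend B ⟩
  det B                                                             ∎
  where
  open ≡-Reasoning
  first-minor : map (removeCol zero) (map padᵥ B ∷ʳ ê lastᶠ) ≡ extend B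
  first-minor = trans (map-∷ʳ (removeCol zero) (ê lastᶠ) (map padᵥ B))
                      (cong₂ _∷ʳ_ (sym (map-∘ (removeCol zero) padᵥ B)) (ê-fromℕ m))

det-transpose-padM : ∀ {m} (B : Mat m) → det (transpose (padM B)) ≡ det (transpose B)
det-transpose-padM B = trans (cong det (transpose-padM B)) (det-padM (transpose B))

-- Symplectic frames

gram : ∀ {m} → Mat m → Mat m
gram C = tabulate (λ i → tabulate (λ j → ω (lookup C i) (lookup C j)))

I : ∀ {m} → Mat m
I = tabulate ê

lookup-I : ∀ {m} (i : Fin m) → lookup I i ≡ ê i
lookup-I i = lookup∘tabulate ê i

-- a record rather than the bare equation, so that C can be inferred from a proof
record Symplectic {m} (C : Mat m) : Set where
  constructor gram≡gram-I
  field gram≡ : gram C ≡ gram I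

Symplectic-irrelevant : ∀ {m} {C : Mat m} (s t : Symplectic C) → s ≡ t
Symplectic-irrelevant (gram≡gram-I s) (gram≡gram-I t) = cong gram≡gram-I (uip s t)

Sp : ℕ → Set
Sp m = Σ (Mat m) Symplectic

ω-gram-I : ∀ {m} (i j : Fin m) → entry (gram I) i j ≡ ω (ê i) (ê j)
ω-gram-I i j = trans (entry-tabulate (λ i j → ω (lookup I i) (lookup I j)) i j) (cong₂ ω (lookup-I i) (lookup-I j))

Symplectic⇒ω : ∀ {m} {C : Mat m} → Symplectic C → ∀ i j → ω (lookup C i) (lookup C j) ≡ ω (ê i) (ê j)
Symplectic⇒ω {C = C} (gram≡gram-I s) i j = trans (sym (entry-tabulate (λ i j → ω (lookup C i) (lookup C j)) i j))
                                                  (trans (cong (λ G → entry G i j) s) (ω-gram-I i j))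

ω⇒Symplectic : ∀ {m} {C : Mat m} → (∀ i j → ω (lookup C i) (lookup C j) ≡ ω (ê i) (ê j)) → Symplectic C
ω⇒Symplectic {C = C} h = gram≡gram-I $ entry-injective λ i j →
  trans (entry-tabulate (λ i j → ω (lookup C i) (lookup C j)) i j) (trans (h i j) (sym (ω-gram-I i j)))

map-Symplectic : ∀ {m} (g : Vec₂ m → Vec₂ m) → (∀ x y → ω (g x) (g y) ≡ ω x y) → ∀ {C} → Symplectic C → Symplectic (map g C)
map-Symplectic g g-preserves {C} s = ω⇒Symplectic λ i j →
  trans (cong₂ ω (lookup-map i g C) (lookup-map j g C)) (trans (g-preserves _ _) (Symplectic⇒ω s i j))

padᵥ-ê : ∀ {m} (a : Fin m) → padᵥ (ê a) ≡ ê (suc (inject₁ a))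
padᵥ-ê {m} a = lookup-injective λ k → trans (at (position k)) (sym (lookup-ê (suc (inject₁ a)) k))
  where
  at : ∀ {k} → Position k → lookup (padᵥ (ê a)) k ≡ δ k (suc (inject₁ a))
  at first = refl
  at (middle i) = trans (padᵥ-middle (ê a) i) (trans (lookup-ê a i) (sym (δ-inject₁ i a)))
  at last = trans (padᵥ-last (ê a)) (sym (δ-≢ {i = lastᶠ {m}} (fromℕ≢inject₁ ∘ suc-injective)))

padM-I : ∀ {m} → padM (I {m}) ≡ I
padM-I {m} = lookup-injective λ k → trans (lookup-padM I k) (trans (at (position k)) (sym (lookup-I k)))
  where
  at : ∀ {k} (pk : Position k) → padRow I pk ≡ ê k
  at first = refl
  at (middle i) = trans (cong padᵥ (lookup-I i)) (padᵥ-ê i)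
  at last = refl

ω-padRow : ∀ {m} (B B′ : Mat m) → (∀ a b → ω (lookup B a) (lookup B b) ≡ ω (lookup B′ a) (lookup B′ b)) →
  ∀ {k l} (pk : Position k) (pl : Position l) → ω (padRow B pk) (padRow B pl) ≡ ω (padRow B′ pk) (padRow B′ pl)
ω-padRow {m} B B′ h = go
  where
  both-false : ∀ {a b} → a ≡ false → b ≡ false → a ≡ b
  both-false a≡false b≡false = trans a≡false (sym b≡false)
  padᵥ-first : ∀ x → ω (padᵥ x) (ê zero) ≡ false
  padᵥ-first x = trans (ω-ê-first (padᵥ x)) (padᵥ-last x)
  padᵥ-last′ : ∀ x → ω (padᵥ x) (ê lastᶠ) ≡ false
  padᵥ-last′ x = ω-ê-last (padᵥ x)
  go : ∀ {k l} (pk : Position k) (pl : Position l) → ω (padRow B pk) (padRow B pl) ≡ ω (padRow B′ pk) (padRow B′ pl)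
  go first first = refl
  go first (middle b) = both-false (trans (ω-sym (ê zero) (padᵥ (lookup B b))) (padᵥ-first (lookup B b)))
                                   (trans (ω-sym (ê zero) (padᵥ (lookup B′ b))) (padᵥ-first (lookup B′ b)))
  go first last = refl
  go (middle a) first = both-false (padᵥ-first (lookup B a)) (padᵥ-first (lookup B′ a))
  go (middle a) (middle b) = trans (ω-padᵥ (lookup B a) (lookup B b)) (trans (h a b) (sym (ω-padᵥ (lookup B′ a) (lookup B′ b))))
  go (middle a) last = both-false (padᵥ-last′ (lookup B a)) (padᵥ-last′ (lookup B′ a))
  go last first = refl
  go last (middle b) = both-false (trans (ω-sym (ê lastᶠ) (padᵥ (lookup B b))) (padᵥ-last′ (lookup B b)))
                                  (trans (ω-sym (ê lastᶠ) (padᵥ (lookup B′ b))) (padᵥ-last′ (lookup B′ b)))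
  go last last = refl

padM-Symplectic : ∀ {m} {B : Mat m} → Symplectic B → Symplectic (padM B)
padM-Symplectic {B = B} s = ω⇒Symplectic λ k l → begin
  ω (lookup (padM B) k) (lookup (padM B) l)          ≡⟨ cong₂ ω (lookup-padM B k) (lookup-padM B l) ⟩
  ω (padRow B (position k)) (padRow B (position l))  ≡⟨ ω-padRow B I B-like-I (position k) (position l) ⟩
  ω (padRow I (position k)) (padRow I (position l))  ≡⟨ cong₂ ω (lookup-padM I k) (lookup-padM I l) ⟨
  ω (lookup (padM I) k) (lookup (padM I) l)          ≡⟨ cong (λ X → ω (lookup X k) (lookup X l)) padM-I ⟩
  ω (lookup I k) (lookup I l)                        ≡⟨ cong₂ ω (lookup-I k) (lookup-I l) ⟩
  ω (ê k) (ê l)                                      ∎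
  where
  open ≡-Reasoning
  B-like-I : ∀ a b → ω (lookup B a) (lookup B b) ≡ ω (lookup I a) (lookup I b)
  B-like-I a b = trans (Symplectic⇒ω s a b) (sym (cong₂ ω (lookup-I a) (lookup-I b)))

module _ {m : ℕ} {X : Mat (suc (suc m))} (s : Symplectic X) (X₀ : lookup X zero ≡ ê zero) (Xₗ : lookup X lastᶠ ≡ ê lastᶠ) where

  private
    row : Fin m → Vec₂ (suc (suc m))
    row a = lookup X (suc (inject₁ a))

    row-first : ∀ a → lookup (row a) zero ≡ false
    row-first a = begin
      lookup (row a) zero                ≡⟨ ω-ê-last (row a) ⟨
      ω (row a) (ê lastᶠ)                ≡⟨ cong (ω (row a)) Xₗ ⟨
      ω (row a) (lookup X lastᶠ)         ≡⟨ Symplectic⇒ω s (suc (inject₁ a)) lastᶠ ⟩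
      ω (ê (suc (inject₁ a))) (ê lastᶠ)  ≡⟨ ω-ê-last (ê (suc (inject₁ a))) ⟩
      lookup (ê (suc (inject₁ a))) zero  ≡⟨ lookup-ê (suc (inject₁ a)) zero ⟩
      false                              ∎
      where open ≡-Reasoning

    row-last : ∀ a → lookup (row a) lastᶠ ≡ false
    row-last a = begin
      lookup (row a) lastᶠ                ≡⟨ ω-ê-first (row a) ⟨
      ω (row a) (ê zero)                  ≡⟨ cong (ω (row a)) X₀ ⟨
      ω (row a) (lookup X zero)           ≡⟨ Symplectic⇒ω s (suc (inject₁ a)) zero ⟩
      ω (ê (suc (inject₁ a))) (ê zero)    ≡⟨ ω-ê-first (ê (suc (inject₁ a))) ⟩
      lookup (ê (suc (inject₁ a))) lastᶠ  ≡⟨ lookup-ê (suc (inject₁ a)) lastᶠ ⟩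
      δ lastᶠ (suc (inject₁ a))           ≡⟨ δ-≢ {i = lastᶠ {m}} (fromℕ≢inject₁ ∘ suc-injective) ⟩
      false                               ∎
      where open ≡-Reasoning

    padᵥ-inner-row : ∀ a → padᵥ (inner (row a)) ≡ row a
    padᵥ-inner-row a = padᵥ-inner (row a) (row-first a) (row-last a)

  unpadM-Symplectic : Symplectic (unpadM X)
  unpadM-Symplectic = ω⇒Symplectic λ a b → begin
    ω (lookup (unpadM X) a) (lookup (unpadM X) b)    ≡⟨ cong₂ ω (lookup-unpadM X a) (lookup-unpadM X b) ⟩
    ω (inner (row a)) (inner (row b))                ≡⟨ ω-padᵥ (inner (row a)) (inner (row b)) ⟨
    ω (padᵥ (inner (row a))) (padᵥ (inner (row b)))  ≡⟨ cong₂ ω (padᵥ-inner-row a) (padᵥ-inner-row b) ⟩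
    ω (row a) (row b)                                ≡⟨ Symplectic⇒ω s (suc (inject₁ a)) (suc (inject₁ b)) ⟩
    ω (ê (suc (inject₁ a))) (ê (suc (inject₁ b)))    ≡⟨ cong₂ ω (padᵥ-ê a) (padᵥ-ê b) ⟨
    ω (padᵥ (ê a)) (padᵥ (ê b))                      ≡⟨ ω-padᵥ (ê a) (ê b) ⟩
    ω (ê a) (ê b)                                    ∎
    where open ≡-Reasoning

  padM-unpadM : padM (unpadM X) ≡ X
  padM-unpadM = lookup-injective λ k → trans (lookup-padM (unpadM X) k) (at (position k))
    where
    at : ∀ {k} (pk : Position k) → padRow (unpadM X) pk ≡ lookup X k
    at first = sym X₀
    at (middle a) = trans (cong padᵥ (lookup-unpadM X a)) (padᵥ-inner-row a)
    at last = sym Xₗ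

ω-first-last-rows : ∀ {m} {C : Mat (suc (suc m))} → Symplectic C → ω (lookup C zero) (lookup C lastᶠ) ≡ true
ω-first-last-rows {m} s = trans (Symplectic⇒ω s zero lastᶠ) (ω-first-last {m})

nonzero-first-row : ∀ {m} {C : Mat (suc (suc m))} → Symplectic C → nonzero (lookup C zero) ≡ true
nonzero-first-row {C = C} s with ω≡true⇒lookup (lookup C zero) (lookup C lastᶠ) (ω-first-last-rows s)
... | k , C₀ₖ = lookup⇒nonzero (lookup C zero) k C₀ₖ

SpWhere : ∀ N → (Mat N → Bool) → Set
SpWhere N P = Σ (Sp N) (λ (C , _) → P C ≡ true)

SpWhere-≡ : ∀ {N P} {C C′ : Mat N} {s s′ h h′} → C ≡ C′ → _≡_ {A = SpWhere N P} ((C , s) , h) ((C′ , s′) , h′)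
SpWhere-≡ {s = s} {s′} {h} {h′} refl rewrite Symplectic-irrelevant s s′ | uip h h′ = refl

map-inverse : ∀ {A : Set} {n} {g h : A → A} → (∀ x → g (h x) ≡ x) → (xs : Vec A n) → map g (map h xs) ≡ xs
map-inverse {g = g} {h} g∘h≗id xs = trans (sym (map-∘ g h xs)) (trans (map-cong g∘h≗id xs) (map-id xs))

-- Decomposition of symplectic frames

module _ {m : ℕ} (alt : Alternating (suc (suc m))) where

  private
    V = Vec₂ (suc (suc m))

  expand : V → V → Mat m → Mat (suc (suc m))
  expand e f B = map (τs (carry alt e f)) (padM B)

  reduce : Mat (suc (suc m)) → Mat m
  reduce C = unpadM (map (τs⁻¹ (carry alt (lookup C zero) (lookup C lastᶠ))) C)

  expand-Symplectic : ∀ e f {B} → Symplectic B → Symplectic (expand e f B)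
  expand-Symplectic e f s = map-Symplectic (τs (carry alt e f)) (τs-preserves-ω alt (carry alt e f)) (padM-Symplectic s)

  det-transpose-expand : ∀ e f B → det (transpose (expand e f B)) ≡ det (transpose B)
  det-transpose-expand e f B = trans (det-transpose-τs alt (carry alt e f) (padM B)) (det-transpose-padM B)

  module _ (e f : V) (ωef : ω e f ≡ true) (B : Mat m) where

    expand-first : lookup (expand e f B) zero ≡ e
    expand-first = trans (lookup-map zero (τs (carry alt e f)) (padM B)) (carry-first alt e f ωef)

    expand-last : lookup (expand e f B) lastᶠ ≡ f
    expand-last = trans (lookup-map lastᶠ (τs (carry alt e f)) (padM B))
                        (trans (cong (τs (carry alt e f)) (padM-last B)) (carry-last alt e f ωef))

    reduce-expand : reduce (expand e f B) ≡ B
    reduce-expand = begin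
      unpadM (map (τs⁻¹ (carry alt (lookup C zero) (lookup C lastᶠ))) C)
        ≡⟨ cong₂ (λ e′ f′ → unpadM (map (τs⁻¹ (carry alt e′ f′)) C)) expand-first expand-last ⟩
      unpadM (map (τs⁻¹ T) (map (τs T) (padM B)))
        ≡⟨ cong unpadM (map-inverse (τs⁻¹-τs alt T) (padM B)) ⟩
      unpadM (padM B)
        ≡⟨ unpadM-padM B ⟩
      B ∎
      where
      open ≡-Reasoning
      C = expand e f B
      T = carry alt e f

  module _ {C : Mat (suc (suc m))} (s : Symplectic C) where

    private
      T = carry alt (lookup C zero) (lookup C lastᶠ)
      X = map (τs⁻¹ T) C

      X-Symplectic : Symplectic X
      X-Symplectic = map-Symplectic (τs⁻¹ T) (τs⁻¹-preserves-ω alt T) s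

      pulled-back : ∀ {k} {x : V} → τs T x ≡ lookup C k → lookup X k ≡ x
      pulled-back {k} {x} τs-x≡Cₖ = trans (lookup-map k (τs⁻¹ T) C) (trans (cong (τs⁻¹ T) (sym τs-x≡Cₖ)) (τs⁻¹-τs alt T x))

      X₀ : lookup X zero ≡ ê zero
      X₀ = pulled-back (carry-first alt (lookup C zero) (lookup C lastᶠ) (ω-first-last-rows s))

      Xₗ : lookup X lastᶠ ≡ ê lastᶠ
      Xₗ = pulled-back (carry-last alt (lookup C zero) (lookup C lastᶠ) (ω-first-last-rows s))

    reduce-Symplectic : Symplectic (reduce C)
    reduce-Symplectic = unpadM-Symplectic X-Symplectic X₀ Xₗ

    expand-reduce : expand (lookup C zero) (lookup C lastᶠ) (reduce C) ≡ C
    expand-reduce = trans (cong (map (τs T)) (padM-unpadM X-Symplectic X₀ Xₗ)) (map-inverse (τs-τs⁻¹ alt T) C)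

det-symplectic : ∀ k (C : Mat (k * 2)) → Symplectic C → det (transpose C) ≡ true
det-symplectic zero [] s = refl
det-symplectic (suc k) C s = begin
  det (transpose C)                                  ≡⟨ cong (det ∘ transpose) (expand-reduce alt s) ⟨
  det (transpose (expand alt C₀ Cₗ (reduce alt C)))  ≡⟨ det-transpose-expand alt C₀ Cₗ (reduce alt C) ⟩
  det (transpose (reduce alt C))                     ≡⟨ det-symplectic k (reduce alt C) (reduce-Symplectic alt s) ⟩
  true                                               ∎
  where
  open ≡-Reasoning
  alt = alternating (suc k)
  C₀ = lookup C zero
  Cₗ = lookup C lastᶠ

Solutions : ∀ {m} → (Vec₂ m → Bool) → Set
Solutions {m} p = Σ (Vec₂ m) (λ v → p v ≡ true)

SpWithFirstRow : ∀ {m} → (Vec₂ (suc (suc m)) → Bool) → Set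
SpWithFirstRow {m} p = SpWhere (suc (suc m)) (λ C → p (lookup C zero))

HyperbolicPairs : ∀ {m} → (Vec₂ (suc (suc m)) → Bool) → Set
HyperbolicPairs p = Σ (Solutions p) (λ (e , _) → Solutions (ω e))

module _ {m : ℕ} (alt : Alternating (suc (suc m))) (p : Vec₂ (suc (suc m)) → Bool) where

  Sp-split : SpWithFirstRow p ↔ (HyperbolicPairs p × Sp m)
  Sp-split = mk↔ₛ′ split join split-join join-split
    where
    split : SpWithFirstRow p → HyperbolicPairs p × Sp m
    split ((C , s) , pC₀) = ((lookup C zero , pC₀) , (lookup C lastᶠ , ω-first-last-rows s)) , (reduce alt C , reduce-Symplectic alt s)

    join : HyperbolicPairs p × Sp m → SpWithFirstRow p
    join (((e , pe) , (f , ωef)) , (B , s)) =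
      (expand alt e f B , expand-Symplectic alt e f s) , subst (λ x → p x ≡ true) (sym (expand-first alt e f ωef B)) pe

    split-join : ∀ y → split (join y) ≡ y
    split-join (((e , pe) , (f , ωef)) , (B , s)) =
      components-≡ (expand-first alt e f ωef B) (expand-last alt e f ωef B) (reduce-expand alt e f ωef B)
      where
      components-≡ : ∀ {e′ f′ B′ pe′ ωe′f′ s′} → e′ ≡ e → f′ ≡ f → B′ ≡ B →
        _≡_ {A = HyperbolicPairs p × Sp m} (((e′ , pe′) , (f′ , ωe′f′)) , (B′ , s′)) (((e , pe) , (f , ωef)) , (B , s))
      components-≡ {pe′ = pe′} {ωe′f′} {s′} refl refl refl
        rewrite uip pe′ pe | uip ωe′f′ ωef | Symplectic-irrelevant s′ s = refl

    join-split : ∀ x → join (split x) ≡ x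
    join-split ((C , s) , pC₀) = SpWhere-≡ (expand-reduce alt s)

-- Counting

Σ-↔-Fin : ∀ {A : Set} {B : A → Set} {a b} → A ↔ Fin a → (∀ x → B x ↔ Fin b) → Σ A B ↔ Fin (a * b)
Σ-↔-Fin {A} {B} {a} {b} A↔a B↔b =
  Σ A B          ↔⟨ congˡ (λ {x} → B↔b x) ⟩
  (A × Fin b)     ↔⟨ A↔a ×-↔ ↔-refl ⟩
  (Fin a × Fin b) ↔⟨ *↔× ⟨
  Fin (a * b)    ∎
  where open EquationalReasoning

count₂ : ∀ m → (Vec₂ m → Bool) → ℕ
count₂ zero p = if p [] then 1 else 0
count₂ (suc m) p = count₂ m (p ∘ (false ∷_)) + count₂ m (p ∘ (true ∷_))

count₂-↔ : ∀ m (p : Vec₂ m → Bool) → Solutions p ↔ Fin (count₂ m p)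
count₂-↔ zero p with p [] in p[]
... | true = mk↔ₛ′ (λ _ → zero) (λ _ → [] , p[]) (λ { zero → refl }) (λ { ([] , h) → cong ([] ,_) (uip p[] h) })
... | false = mk↔ₛ′ (λ { ([] , h) → false≢true (trans (sym p[]) h) }) (λ ()) (λ ()) (λ { ([] , h) → false≢true (trans (sym p[]) h) })
  where
  false≢true : ∀ {A : Set} → false ≡ true → A
  false≢true ()
count₂-↔ (suc m) p =
  Solutions p                                                   ↔⟨ split-head ⟩
  (Solutions (p ∘ (false ∷_)) ⊎ Solutions (p ∘ (true ∷_)))      ↔⟨ count₂-↔ m (p ∘ (false ∷_)) ⊎-↔ count₂-↔ m (p ∘ (true ∷_)) ⟩
  (Fin (count₂ m (p ∘ (false ∷_))) ⊎ Fin (count₂ m (p ∘ (true ∷_))))  ↔⟨ +↔⊎ ⟨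
  Fin (count₂ (suc m) p)                                        ∎
  where
  open EquationalReasoning
  split-head : Solutions p ↔ (Solutions (p ∘ (false ∷_)) ⊎ Solutions (p ∘ (true ∷_)))
  split-head = mk↔ₛ′ to from to-from from-to
    where
    to : Solutions p → Solutions (p ∘ (false ∷_)) ⊎ Solutions (p ∘ (true ∷_))
    to ((false ∷ v) , h) = inj₁ (v , h)
    to ((true ∷ v) , h) = inj₂ (v , h)
    from : Solutions (p ∘ (false ∷_)) ⊎ Solutions (p ∘ (true ∷_)) → Solutions p
    from (inj₁ (v , h)) = (false ∷ v) , h
    from (inj₂ (v , h)) = (true ∷ v) , h
    to-from : ∀ y → to (from y) ≡ y
    to-from (inj₁ _) = refl
    to-from (inj₂ _) = refl
    from-to : ∀ x → from (to x) ≡ x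
    from-to ((false ∷ v) , h) = refl
    from-to ((true ∷ v) , h) = refl

count₂-cong : ∀ m {p q : Vec₂ m → Bool} → (∀ v → p v ≡ q v) → count₂ m p ≡ count₂ m q
count₂-cong zero p≗q = cong (λ b → if b then 1 else 0) (p≗q [])
count₂-cong (suc m) p≗q = cong₂ _+_ (count₂-cong m (p≗q ∘ (false ∷_))) (count₂-cong m (p≗q ∘ (true ∷_)))

count₂-not : ∀ m (p : Vec₂ m → Bool) → count₂ m p + count₂ m (not ∘ p) ≡ 2 ^ m
count₂-not zero p with p []
... | true = refl
... | false = refl
count₂-not (suc m) p = begin
  (count₂ m p₀ + count₂ m p₁) + (count₂ m (not ∘ p₀) + count₂ m (not ∘ p₁))  ≡⟨ +-interchange (count₂ m p₀) (count₂ m p₁) _ _ ⟩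
  (count₂ m p₀ + count₂ m (not ∘ p₀)) + (count₂ m p₁ + count₂ m (not ∘ p₁))  ≡⟨ cong₂ _+_ (count₂-not m p₀) (count₂-not m p₁) ⟩
  2 ^ m + 2 ^ m                                                              ≡⟨ cong (2 ^ m +_) (+-identityʳ (2 ^ m)) ⟨
  2 ^ suc m                                                                  ∎
  where
  open ≡-Reasoning
  p₀ = p ∘ (false ∷_)
  p₁ = p ∘ (true ∷_)

[a∸1]+a≡2a∸1 : ∀ {a} → 0 < a → (a ∸ 1) + a ≡ 2 * a ∸ 1
[a∸1]+a≡2a∸1 {suc a} _ = cong (a +_) (cong suc (sym (+-identityʳ a)))

double : ∀ a → a + a ≡ 2 * a
double a = cong (a +_) (sym (+-identityʳ a))

count₂-true : ∀ m → count₂ m (λ _ → true) ≡ 2 ^ m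
count₂-true zero = refl
count₂-true (suc m) = trans (cong₂ _+_ (count₂-true m) (count₂-true m)) (double (2 ^ m))

ofParity : ∀ {m} → (Bool → Bool) → Vec₂ m → Bool
ofParity g v = g (par v) ∧ nonzero v

ofParity⇒nonzero : ∀ {m} g (v : Vec₂ m) → ofParity g v ≡ true → nonzero v ≡ true
ofParity⇒nonzero g v h with g (par v)
... | true = h

count₂-odd : ∀ m → count₂ (suc m) (ofParity (λ b → b)) ≡ 2 ^ m
count₂-odd m = trans (count₂-cong (suc m) odd⇒nonzero) (count₂-not m par)
  where
  odd⇒nonzero : ∀ v → par v ∧ nonzero v ≡ par v
  odd⇒nonzero v with par v in odd
  ... | true = par⇒nonzero v odd
  ... | false = refl

count₂-even : ∀ m → count₂ (suc m) (ofParity not) ≡ 2 ^ m ∸ 1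
count₂-even zero = refl
count₂-even (suc m) = begin
  count₂ (suc m) (ofParity not ∘ (false ∷_)) + count₂ (suc m) (ofParity not ∘ (true ∷_))
    ≡⟨ cong₂ _+_ (count₂-even m) (trans (count₂-cong (suc m) odd-tail) (count₂-not m par)) ⟩
  (2 ^ m ∸ 1) + 2 ^ m
    ≡⟨ [a∸1]+a≡2a∸1 (m^n>0 2 m) ⟩
  2 ^ suc m ∸ 1 ∎
  where
  open ≡-Reasoning
  odd-tail : ∀ v → not (not (par v)) ∧ true ≡ par v
  odd-tail v with par v
  ... | true = refl
  ... | false = refl

count₂-nonzero : ∀ m → count₂ m nonzero ≡ 2 ^ m ∸ 1
count₂-nonzero zero = refl
count₂-nonzero (suc m) = trans (cong₂ _+_ (count₂-nonzero m) (count₂-true m)) ([a∸1]+a≡2a∸1 (m^n>0 2 m))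

∙-zero-vector : ∀ {m} (f a : Vec₂ m) → nonzero a ≡ false → f ∙ lookup a ≡ false
∙-zero-vector [] [] _ = refl
∙-zero-vector (x ∷ f) (false ∷ a) a≡0 = trans (cong (_xor f ∙ lookup a) (∧-zeroʳ x)) (∙-zero-vector f a a≡0)

-- f ↦ f ∙ a is a nonzero linear form, so each of its fibres has half of the vectors
count₂-dot : ∀ m (a : Vec₂ (suc m)) c → nonzero a ≡ true → count₂ (suc m) (λ f → f ∙ lookup a xor c) ≡ 2 ^ m
count₂-dot zero (true ∷ []) true _ = refl
count₂-dot zero (true ∷ []) false _ = refl
count₂-dot (suc m) (a₀ ∷ a) c nz with nonzero a in a≢0
... | true = begin
  count₂ (suc m) (λ f → f ∙ lookup a xor c) + count₂ (suc m) (λ f → (a₀ xor f ∙ lookup a) xor c)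
    ≡⟨ cong₂ _+_ (count₂-dot m a c a≢0) (trans (count₂-cong (suc m) (λ f → rotate a₀ (f ∙ lookup a) c)) (count₂-dot m a (a₀ xor c) a≢0)) ⟩
  2 ^ m + 2 ^ m
    ≡⟨ double (2 ^ m) ⟩
  2 ^ suc m ∎
  where
  open ≡-Reasoning
  rotate : ∀ a d c → (a xor d) xor c ≡ d xor (a xor c)
  rotate a d c = trans (cong (_xor c) (xor-comm a d)) (xor-assoc d a c)
count₂-dot (suc m) (true ∷ a) c nz | false = begin
  count₂ (suc m) (λ f → f ∙ lookup a xor c) + count₂ (suc m) (λ f → not (f ∙ lookup a) xor c)
    ≡⟨ cong₂ _+_ (count₂-cong (suc m) (λ f → cong (_xor c) (∙-zero-vector f a a≢0)))
                 (count₂-cong (suc m) (λ f → cong (λ t → not t xor c) (∙-zero-vector f a a≢0))) ⟩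
  count₂ (suc m) (λ _ → c) + count₂ (suc m) (λ _ → not c)
    ≡⟨ count₂-not (suc m) (λ _ → c) ⟩
  2 ^ suc m ∎
  where open ≡-Reasoning

hyperbolic-partners : ∀ {m} (e : Vec₂ (suc m)) → nonzero e ≡ true → Solutions (ω e) ↔ Fin (2 ^ m)
hyperbolic-partners {m} e e≢0 =
  Solutions (ω e)                         ↔⟨ count₂-↔ (suc m) (ω e) ⟩
  Fin (count₂ (suc m) (ω e))              ≡⟨ cong Fin (count₂-cong (suc m) ω-as-dot) ⟩
  Fin (count₂ (suc m) (λ f → f ∙ lookup (reflect e) xor false)) ≡⟨ cong Fin (count₂-dot m (reflect e) false reflect-e≢0) ⟩
  Fin (2 ^ m)                             ∎
  where
  open EquationalReasoning
  ω-as-dot : ∀ f → ω e f ≡ f ∙ lookup (reflect e) xor false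
  ω-as-dot f = trans (ω-sym e f) (trans (∙-cong f (λ k → sym (lookup-reflect e k))) (sym (xor-identityʳ _)))
  reflect-e≢0 : nonzero (reflect e) ≡ true
  reflect-e≢0 with nonzero⇒lookup e e≢0
  ... | k , eₖ = lookup⇒nonzero (reflect e) (opposite k)
                   (trans (lookup-reflect e (opposite k)) (trans (cong (lookup e) (opposite-involutive k)) eₖ))

pairs-card : ∀ {m} (p : Vec₂ (suc (suc m)) → Bool) → (∀ v → p v ≡ true → nonzero v ≡ true) →
  HyperbolicPairs p ↔ Fin (count₂ (suc (suc m)) p * 2 ^ suc m)
pairs-card {m} p p⇒nonzero = Σ-↔-Fin (count₂-↔ (suc (suc m)) p) (λ (e , pe) → hyperbolic-partners e (p⇒nonzero e pe))

first-row-nonzero : ∀ {m} → Sp (suc (suc m)) ↔ SpWithFirstRow nonzero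
first-row-nonzero = mk↔ₛ′ (λ (C , s) → (C , s) , nonzero-first-row s) proj₁ (λ (S , h) → cong (S ,_) (uip _ h)) (λ _ → refl)

spOrder : ℕ → ℕ
spOrder zero = 1
spOrder (suc k) = (2 ^ (suc k * 2) ∸ 1) * 2 ^ suc (k * 2) * spOrder k

Sp-card : ∀ k → Sp (k * 2) ↔ Fin (spOrder k)
Sp-card zero = mk↔ₛ′ (λ _ → zero) (λ _ → [] , gram≡gram-I refl) (λ { zero → refl }) (λ { ([] , s) → cong ([] ,_) (Symplectic-irrelevant _ s) })
Sp-card (suc k) =
  Sp (suc k * 2)                                                   ↔⟨ first-row-nonzero ⟩
  SpWithFirstRow nonzero                                           ↔⟨ Sp-split alt nonzero ⟩
  (HyperbolicPairs nonzero × Sp (k * 2))                           ↔⟨ Σ-↔-Fin (pairs-card nonzero (λ _ nz → nz)) (λ _ → Sp-card k) ⟩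
  Fin (count₂ (suc k * 2) nonzero * 2 ^ suc (k * 2) * spOrder k)  ≡⟨ cong (λ c → Fin (c * 2 ^ suc (k * 2) * spOrder k)) (count₂-nonzero (suc k * 2)) ⟩
  Fin (spOrder (suc k))                                            ∎
  where
  open EquationalReasoning
  alt = alternating (suc k)

-- Moving the total parity into the first row

linComb-I : ∀ {m} (w : Vec₂ m) → linComb w I ≡ w
linComb-I w = lookup-injective λ j → begin
  lookup (linComb w I) j             ≡⟨ lookup-linComb w I j ⟩
  w ∙ (λ k → lookup (lookup I k) j)  ≡⟨ ∙-cong w (λ k → trans (cong (λ r → lookup r j) (lookup-I k)) (trans (lookup-ê k j) (δ-sym j k))) ⟩
  Σ₂ (λ k → lookup w k ∧ δ k j)      ≡⟨ Σ₂-cong (λ k → ∧-comm (lookup w k) (δ k j)) ⟩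
  Σ₂ (λ k → δ k j ∧ lookup w k)      ≡⟨ Σ₂-δ j (lookup w) ⟩
  lookup w j                         ∎
  where open ≡-Reasoning

ω-linComb : ∀ {m p} (x : Vec₂ m) (w : Vec₂ p) (X : Vec (Vec₂ m) p) → ω x (linComb w X) ≡ w ∙ (λ k → ω x (lookup X k))
ω-linComb x w X = trans (∙-cong x (λ i → lookup-linComb w X (opposite i))) (∙-comm x w (λ i k → lookup (lookup X k) (opposite i)))

par-⊕ᵥ : ∀ {m} (x y : Vec₂ m) → par (x ⊕ᵥ y) ≡ par x xor par y
par-⊕ᵥ x y = trans (Σ₂-cong (lookup-⊕ᵥ x y)) (Σ₂-xor (lookup x) (lookup y))

par-·ᵥ : ∀ {m} c (x : Vec₂ m) → par (c ·ᵥ x) ≡ c ∧ par x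
par-·ᵥ c x = trans (Σ₂-cong (lookup-·ᵥ c x)) (Σ₂-∧ˡ c (lookup x))

par-linComb : ∀ {m p} (w : Vec₂ p) (X : Vec (Vec₂ m) p) → par (linComb w X) ≡ w ∙ (λ k → par (lookup X k))
par-linComb w X = begin
  Σ₂ (lookup (linComb w X))                                 ≡⟨ Σ₂-cong (lookup-linComb w X) ⟩
  Σ₂ (λ j → Σ₂ (λ k → lookup w k ∧ lookup (lookup X k) j))  ≡⟨ Σ₂-comm (λ j k → lookup w k ∧ lookup (lookup X k) j) ⟩
  Σ₂ (λ k → Σ₂ (λ j → lookup w k ∧ lookup (lookup X k) j))  ≡⟨ Σ₂-cong (λ k → Σ₂-∧ˡ (lookup w k) (lookup (lookup X k))) ⟩
  w ∙ (λ k → par (lookup X k))                              ∎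
  where open ≡-Reasoning

parM : ∀ {m} → Mat m → Bool
parM C = Σ₂ (λ j → par (lookup C j))

module ParityShift {m : ℕ} (alt : Alternating (suc (suc m))) where

  private
    V = Vec₂ (suc (suc m))

  -- left multiplication by the transvection matrix I + Ω u uᵀ, where Ω = gram I
  u : V
  u = tabulate (λ k → not (δ k zero))

  σ : Fin (suc (suc m)) → Bool
  σ j = ω (ê j) u

  shift : Mat (suc (suc m)) → Mat (suc (suc m))
  shift C = tabulate (λ j → lookup C j ⊕ᵥ σ j ·ᵥ linComb u C)

  lookup-shift : ∀ C j → lookup (shift C) j ≡ lookup C j ⊕ᵥ σ j ·ᵥ linComb u C
  lookup-shift C j = lookup∘tabulate (λ j → lookup C j ⊕ᵥ σ j ·ᵥ linComb u C) j

  linComb-shift : ∀ C → linComb u (shift C) ≡ linComb u C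
  linComb-shift C = lookup-injective λ i → begin
    lookup (linComb u (shift C)) i
      ≡⟨ lookup-linComb u (shift C) i ⟩
    u ∙ (λ k → lookup (lookup (shift C) k) i)
      ≡⟨ ∙-cong u (λ k → trans (cong (λ r → lookup r i) (lookup-shift C k))
                               (trans (lookup-⊕ᵥ (lookup C k) _ i) (cong (entry C k i xor_) (lookup-·ᵥ (σ k) (linComb u C) i)))) ⟩
    u ∙ (λ k → entry C k i xor (σ k ∧ lookup (linComb u C) i))
      ≡⟨ ∙-xor u (λ k → entry C k i) (λ k → σ k ∧ lookup (linComb u C) i) ⟩
    u ∙ (λ k → entry C k i) xor u ∙ (λ k → σ k ∧ lookup (linComb u C) i)
      ≡⟨ cong₂ _xor_ (sym (lookup-linComb u C i)) (∙-∧ʳ u σ (lookup (linComb u C) i)) ⟩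
    lookup (linComb u C) i xor (u ∙ σ ∧ lookup (linComb u C) i)
      ≡⟨ cong (λ t → lookup (linComb u C) i xor (t ∧ lookup (linComb u C) i)) u∙σ≡false ⟩
    lookup (linComb u C) i xor false
      ≡⟨ xor-identityʳ _ ⟩
    lookup (linComb u C) i ∎
    where
    open ≡-Reasoning
    u∙σ≡false : u ∙ σ ≡ false
    u∙σ≡false = trans (∙-cong u (λ k → ω-êˡ u k)) (alt u)

  shift-involutive : ∀ C → shift (shift C) ≡ C
  shift-involutive C = lookup-injective λ j → begin
    lookup (shift (shift C)) j                              ≡⟨ lookup-shift (shift C) j ⟩
    lookup (shift C) j ⊕ᵥ σ j ·ᵥ linComb u (shift C)        ≡⟨ cong₂ (λ x y → x ⊕ᵥ σ j ·ᵥ y) (lookup-shift C j) (linComb-shift C) ⟩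
    lookup C j ⊕ᵥ σ j ·ᵥ linComb u C ⊕ᵥ σ j ·ᵥ linComb u C  ≡⟨ ⊕ᵥ-cancelʳ (lookup C j) (σ j ·ᵥ linComb u C) ⟩
    lookup C j                                              ∎
    where open ≡-Reasoning

  ω-linComb-u : ∀ {C} → Symplectic C → ∀ i → ω (lookup C i) (linComb u C) ≡ σ i
  ω-linComb-u {C} s i = begin
    ω (lookup C i) (linComb u C)             ≡⟨ ω-linComb (lookup C i) u C ⟩
    u ∙ (λ k → ω (lookup C i) (lookup C k))  ≡⟨ ∙-cong u (λ k → trans (Symplectic⇒ω s i k) (cong (ω (ê i)) (sym (lookup-I k)))) ⟩
    u ∙ (λ k → ω (ê i) (lookup I k))         ≡⟨ ω-linComb (ê i) u I ⟨
    ω (ê i) (linComb u I)                    ≡⟨ cong (ω (ê i)) (linComb-I u) ⟩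
    σ i                                      ∎
    where open ≡-Reasoning

  shift-Symplectic : ∀ {C} → Symplectic C → Symplectic (shift C)
  shift-Symplectic {C} s = ω⇒Symplectic λ i j →
    trans (cong₂ ω (lookup-shift C i) (lookup-shift C j))
          (trans (ω-shear alt (lookup C i) (lookup C j) (linComb u C) (ω-linComb-u s i) (ω-linComb-u s j)) (Symplectic⇒ω s i j))

  par-shift-first : ∀ C → par (lookup (shift C) zero) ≡ parM C
  par-shift-first C = begin
    par (lookup (shift C) zero)
      ≡⟨ cong par (lookup-shift C zero) ⟩
    par (lookup C zero ⊕ᵥ σ zero ·ᵥ linComb u C)
      ≡⟨ trans (par-⊕ᵥ (lookup C zero) _) (cong (par (lookup C zero) xor_) (par-·ᵥ (σ zero) (linComb u C))) ⟩
    par (lookup C zero) xor (σ zero ∧ par (linComb u C))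
      ≡⟨ cong₂ (λ s t → par (lookup C zero) xor (s ∧ t)) σ₀ (par-linComb u C) ⟩
    par (lookup C zero) xor u ∙ (λ k → par (lookup C k))
      ≡⟨ cong (par (lookup C zero) xor_) (Σ₂-cong u-tail) ⟩
    parM C ∎
    where
    open ≡-Reasoning
    σ₀ : σ zero ≡ true
    σ₀ = trans (ω-êˡ u zero) (lookup∘tabulate (λ k → not (δ k zero)) (lastᶠ {m}))
    u-tail : ∀ k → lookup u (suc k) ∧ par (lookup C (suc k)) ≡ par (lookup C (suc k))
    u-tail k = cong (_∧ par (lookup C (suc k))) (lookup∘tabulate (λ k → not (δ k zero)) (suc k))

SpOfParity : (Bool → Bool) → ℕ → Set
SpOfParity g N = SpWhere N (g ∘ parM)

module _ {m : ℕ} (alt : Alternating (suc (suc m))) (g : Bool → Bool) where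
  open ParityShift alt

  parity-to-first-row : SpOfParity g (suc (suc m)) ↔ SpWithFirstRow (ofParity g)
  parity-to-first-row = mk↔ₛ′ to from (λ ((C , _) , _) → SpWhere-≡ (shift-involutive C)) (λ ((C , _) , _) → SpWhere-≡ (shift-involutive C))
    where
    to : SpOfParity g (suc (suc m)) → SpWithFirstRow (ofParity g)
    to ((C , s) , gC) = (shift C , shift-Symplectic s) ,
      cong₂ _∧_ (trans (cong g (par-shift-first C)) gC) (nonzero-first-row (shift-Symplectic s))
    from : SpWithFirstRow (ofParity g) → SpOfParity g (suc (suc m))
    from ((C , s) , h) = (shift C , shift-Symplectic s) ,
      trans (cong g (trans (sym (par-shift-first (shift C))) (cong (λ X → par (lookup X zero)) (shift-involutive C)))) (∧-conicalˡ _ _ h)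

SpOfParity-card : ∀ k g → SpOfParity g (suc k * 2) ↔ Fin (count₂ (suc k * 2) (ofParity g) * 2 ^ suc (k * 2) * spOrder k)
SpOfParity-card k g =
  SpOfParity g (suc k * 2)                     ↔⟨ parity-to-first-row alt g ⟩
  SpWithFirstRow (ofParity g)                  ↔⟨ Sp-split alt (ofParity g) ⟩
  (HyperbolicPairs (ofParity g) × Sp (k * 2))  ↔⟨ Σ-↔-Fin (pairs-card (ofParity g) (ofParity⇒nonzero g)) (λ _ → Sp-card k) ⟩
  Fin (count₂ (suc k * 2) (ofParity g) * 2 ^ suc (k * 2) * spOrder k) ∎
  where
  open EquationalReasoning
  alt = alternating (suc k)

-- The form M and the number of ones

≡ᵇ-+ˡ : ∀ c {x y} → (c + x ≡ᵇ c + y) ≡ (x ≡ᵇ y)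
≡ᵇ-+ˡ zero = refl
≡ᵇ-+ˡ (suc c) = ≡ᵇ-+ˡ c

Mform-block₁₁ : ∀ {n} (a b : Fin n) → false ≡ (toℕ a + toℕ b ≡ᵇ (n + n) ∸ 1)
Mform-block₁₁ {suc k} a b = sym (≢⇒≡ᵇ-false (<⇒≢ (+-mono-≤-< (s≤s⁻¹ (toℕ<n a)) (toℕ<n b))))

Mform-block₁₂ : ∀ {n} (a b : Fin n) → (toℕ a + toℕ b ≡ᵇ n ∸ 1) ≡ (toℕ a + (n + toℕ b) ≡ᵇ (n + n) ∸ 1)
Mform-block₁₂ {suc k} a b = trans (sym (≡ᵇ-+ˡ (suc k))) (cong₂ _≡ᵇ_ (+-swapˡ (suc k) (toℕ a) (toℕ b)) (+-comm (suc k) k))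

Mform-block₂₁ : ∀ {n} (a b : Fin n) → (toℕ a + toℕ b ≡ᵇ n ∸ 1) ≡ ((n + toℕ a) + toℕ b ≡ᵇ (n + n) ∸ 1)
Mform-block₂₁ {suc k} a b = trans (sym (≡ᵇ-+ˡ (suc k))) (cong₂ _≡ᵇ_ (sym (+-assoc (suc k) (toℕ a) (toℕ b))) (+-comm (suc k) k))

Mform-block₂₂ : ∀ {n} (a b : Fin n) → false ≡ ((n + toℕ a) + (n + toℕ b) ≡ᵇ (n + n) ∸ 1)
Mform-block₂₂ {suc k} a b = sym (≢⇒≡ᵇ-false (>⇒≢ (+-mono-≤ (m≤m+n (suc k) (toℕ a)) (m≤m+n (suc k) (toℕ b)))))

module _ (n : ℕ) where

  private
    left : ∀ {i : Fin (n + n)} {a} → splitAt n i ≡ inj₁ a → toℕ a ≡ toℕ i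
    left {a = a} eq = trans (sym (toℕ-↑ˡ a n)) (cong toℕ (splitAt⁻¹-↑ˡ eq))

    right : ∀ {i : Fin (n + n)} {a} → splitAt n i ≡ inj₂ a → n + toℕ a ≡ toℕ i
    right {a = a} eq = trans (sym (toℕ-↑ʳ n a)) (cong toℕ (splitAt⁻¹-↑ʳ eq))

    indices : ∀ {x y} {i j : Fin (n + n)} → x ≡ toℕ i → y ≡ toℕ j → (x + y ≡ᵇ (n + n) ∸ 1) ≡ (toℕ i + toℕ j ≡ᵇ (n + n) ∸ 1)
    indices refl refl = refl

  -- the block function of Mform is local to Defs, so Mform is unfolded by matching it against tabulate
  Mform-entry : ∀ (i j : Fin (n + n)) → entry (Mform n) i j ≡ (toℕ i + toℕ j ≡ᵇ (n + n) ∸ 1)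
  Mform-entry i j rewrite entry-≡tabulate (Mform n) refl i j with splitAt n i in split-i | splitAt n j in split-j
  ... | inj₁ a | inj₁ b = trans (Mform-block₁₁ a b) (indices (left split-i) (left split-j))
  ... | inj₁ a | inj₂ b = trans (Mform-block₁₂ a b) (indices (left split-i) (right split-j))
  ... | inj₂ a | inj₁ b = trans (Mform-block₂₁ a b) (indices (right split-i) (left split-j))
  ... | inj₂ a | inj₂ b = trans (Mform-block₂₂ a b) (indices (right split-i) (right split-j))

antidiagonal-δ : ∀ {N} (i j : Fin N) → (toℕ i + toℕ j ≡ᵇ N ∸ 1) ≡ δ (opposite i) j
antidiagonal-δ {suc M} i j = trans (≡ᵇ-⇔ to from) (cong (_≡ᵇ toℕ j) (sym (opposite-prop i)))
  where
  to : toℕ i + toℕ j ≡ M → M ∸ toℕ i ≡ toℕ j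
  to i+j≡M = trans (cong (_∸ toℕ i) (sym i+j≡M)) (m+n∸m≡n (toℕ i) (toℕ j))
  from : M ∸ toℕ i ≡ toℕ j → toℕ i + toℕ j ≡ M
  from M-i≡j = trans (cong (toℕ i +_) (sym M-i≡j)) (m+[n∸m]≡n (s≤s⁻¹ (toℕ<n i)))

gram-I-entry : ∀ {m} (i j : Fin m) → entry (gram I) i j ≡ δ (opposite i) j
gram-I-entry i j = trans (ω-gram-I i j) (trans (ω-êˡ (ê j) i) (lookup-ê j (opposite i)))

Mform≡gram-I : ∀ n → Mform n ≡ gram I
Mform≡gram-I n = entry-injective λ i j → trans (Mform-entry n i j) (trans (antidiagonal-δ i j) (sym (gram-I-entry i j)))

entry-⊗ : ∀ {m} (X Y : Mat m) i j → entry (X ⊗ Y) i j ≡ lookup X i ∙ (λ k → entry Y k j)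
entry-⊗ X Y = entry-tabulate (λ i j → lookup X i ∙ (λ k → entry Y k j))

entry-gram-I-⊗ : ∀ {m} (A : Mat m) k j → entry (gram I ⊗ A) k j ≡ entry A (opposite k) j
entry-gram-I-⊗ A k j = begin
  entry (gram I ⊗ A) k j                       ≡⟨ entry-⊗ (gram I) A k j ⟩
  Σ₂ (λ l → entry (gram I) k l ∧ entry A l j)  ≡⟨ Σ₂-cong (λ l → cong (_∧ entry A l j) (trans (gram-I-entry k l) (δ-sym (opposite k) l))) ⟩
  Σ₂ (λ l → δ l (opposite k) ∧ entry A l j)    ≡⟨ Σ₂-δ (opposite k) (λ l → entry A l j) ⟩
  entry A (opposite k) j                       ∎
  where open ≡-Reasoning

transpose-⊗-gram-I : ∀ {m} (A : Mat m) → transpose A ⊗ (gram I ⊗ A) ≡ gram (transpose A)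
transpose-⊗-gram-I A = entry-injective λ i j → begin
  entry (transpose A ⊗ (gram I ⊗ A)) i j
    ≡⟨ entry-⊗ (transpose A) (gram I ⊗ A) i j ⟩
  lookup (transpose A) i ∙ (λ k → entry (gram I ⊗ A) k j)
    ≡⟨ ∙-cong (lookup (transpose A) i) (λ k → trans (entry-gram-I-⊗ A k j) (sym (entry-transpose A j (opposite k)))) ⟩
  ω (lookup (transpose A) i) (lookup (transpose A) j)
    ≡⟨ entry-tabulate (λ i j → ω (lookup (transpose A) i) (lookup (transpose A) j)) i j ⟨
  entry (gram (transpose A)) i j ∎
  where open ≡-Reasoning

module _ (n : ℕ) where

  symplectic-form⇒Symplectic : ∀ (A : Mat (n + n)) → transpose A ⊗ (Mform n ⊗ A) ≡ Mform n → Symplectic (transpose A)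
  symplectic-form⇒Symplectic A AᵀMA≡M = gram≡gram-I $ begin
    gram (transpose A)           ≡⟨ transpose-⊗-gram-I A ⟨
    transpose A ⊗ (gram I ⊗ A)   ≡⟨ cong (λ M → transpose A ⊗ (M ⊗ A)) (Mform≡gram-I n) ⟨
    transpose A ⊗ (Mform n ⊗ A)  ≡⟨ AᵀMA≡M ⟩
    Mform n                      ≡⟨ Mform≡gram-I n ⟩
    gram I                       ∎
    where open ≡-Reasoning

  Symplectic⇒symplectic-form : ∀ {C : Mat (n + n)} → Symplectic C → transpose (transpose C) ⊗ (Mform n ⊗ transpose C) ≡ Mform n
  Symplectic⇒symplectic-form {C} (gram≡gram-I gram≡) = begin
    transpose (transpose C) ⊗ (Mform n ⊗ transpose C)  ≡⟨ cong (λ M → transpose (transpose C) ⊗ (M ⊗ transpose C)) (Mform≡gram-I n) ⟩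
    transpose (transpose C) ⊗ (gram I ⊗ transpose C)   ≡⟨ transpose-⊗-gram-I (transpose C) ⟩
    gram (transpose (transpose C))                     ≡⟨ cong gram (transpose-involutive C) ⟩
    gram C                                             ≡⟨ gram≡ ⟩
    gram I                                             ≡⟨ Mform≡gram-I n ⟨
    Mform n                                            ∎
    where open ≡-Reasoning

bit : Bool → ℕ
bit b = if b then 1 else 0

%2-+ : ∀ m n {a b} → m % 2 ≡ bit a → n % 2 ≡ bit b → (m + n) % 2 ≡ bit (a xor b)
%2-+ m n {a} {b} m≡a n≡b = trans (%-distribˡ-+ m n 2) (trans (cong₂ (λ x y → (x + y) % 2) m≡a n≡b) (bits a b))
  where
  bits : ∀ a b → (bit a + bit b) % 2 ≡ bit (a xor b)
  bits false false = refl
  bits false true = refl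
  bits true false = refl
  bits true true = refl

countᵇ-%2 : ∀ {m} (v : Vec₂ m) → countᵇ (λ b → b) v % 2 ≡ bit (par v)
countᵇ-%2 [] = refl
countᵇ-%2 (true ∷ v) = %2-+ 1 (countᵇ (λ b → b) v) refl (countᵇ-%2 v)
countᵇ-%2 (false ∷ v) = countᵇ-%2 v

rows-%2 : ∀ {m p} (A : Vec (Vec₂ m) p) → sum (map (countᵇ (λ b → b)) A) % 2 ≡ bit (Σ₂ (λ i → par (lookup A i)))
rows-%2 [] = refl
rows-%2 (r ∷ A) = %2-+ (countᵇ (λ b → b) r) (sum (map (countᵇ (λ b → b)) A)) (countᵇ-%2 r) (rows-%2 A)

parM-transpose : ∀ {m} (A : Mat m) → parM (transpose A) ≡ parM A
parM-transpose A = begin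
  Σ₂ (λ j → Σ₂ (entry (transpose A) j))  ≡⟨ Σ₂-cong (λ j → Σ₂-cong (entry-transpose A j)) ⟩
  Σ₂ (λ j → Σ₂ (λ i → entry A i j))      ≡⟨ Σ₂-comm (entry A) ⟨
  Σ₂ (λ i → Σ₂ (entry A i))              ∎
  where open ≡-Reasoning

ones-%2 : ∀ {m} (A : Mat m) → ones A % 2 ≡ bit (parM (transpose A))
ones-%2 A = trans (rows-%2 A) (cong bit (sym (parM-transpose A)))

*2≡+ : ∀ n → n * 2 ≡ n + n
*2≡+ = solve-∀

det-symplectic′ : ∀ n (C : Mat (n + n)) → Symplectic C → det (transpose C) ≡ true
det-symplectic′ n = subst (λ N → (C : Mat N) → Symplectic C → det (transpose C) ≡ true) (*2≡+ n) (det-symplectic n)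

SpOnes : ℕ → ℕ → Set
SpOnes n t = Σ (Mat (n + n)) (λ A → IsSp n A × (ones A % 2 ≡ t))

module _ (n t : ℕ) (g : Bool → Bool) (g-spec : ∀ b → (bit b ≡ t) ⇔ (g b ≡ true)) where

  SpOnes↔SpOfParity : SpOnes n t ↔ SpOfParity g (n + n)
  SpOnes↔SpOfParity = mk↔ₛ′ to from (λ ((C , _) , _) → SpWhere-≡ (transpose-involutive C)) (λ (A , _) → SpOnes-≡ (transpose-involutive A))
    where
    to : SpOnes n t → SpOfParity g (n + n)
    to (A , ((_ , AᵀMA≡M) , ones≡t)) = (transpose A , symplectic-form⇒Symplectic n A AᵀMA≡M) ,
      Equivalence.to (g-spec (parM (transpose A))) (trans (sym (ones-%2 A)) ones≡t)
    from : SpOfParity g (n + n) → SpOnes n t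
    from ((C , s) , gC) = transpose C , ((det-symplectic′ n C s , Symplectic⇒symplectic-form n s) ,
      trans (ones-%2 (transpose C)) (trans (cong (bit ∘ parM) (transpose-involutive C)) (Equivalence.from (g-spec (parM C)) gC)))
    SpOnes-≡ : ∀ {A A′ : Mat (n + n)} {p p′} → A ≡ A′ → _≡_ {A = SpOnes n t} (A , p) (A′ , p′)
    SpOnes-≡ {p = (d , f) , o} {(d′ , f′) , o′} refl rewrite uip d d′ | uip f f′ | uip o o′ = refl

2^-square-suc : ∀ k → 2 ^ (k + k * suc k) ≡ 2 ^ (k * 2) * 2 ^ (k * k)
2^-square-suc k = trans (cong (2 ^_) (exponent k)) (^-distribˡ-+-* 2 (k * 2) (k * k))
  where
  exponent : ∀ k → k + k * suc k ≡ k * 2 + k * k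
  exponent = solve-∀

2^-double-suc : ∀ k → 2 ^ (2 * suc k) ≡ 2 * (2 * 2 ^ (k * 2))
2^-double-suc k = cong (2 ^_) (exponent k)
  where
  exponent : ∀ k → 2 * suc k ≡ suc (suc (k * 2))
  exponent = solve-∀

spOrder-closed : ∀ k → spOrder k ≡ 2 ^ (k * k) * prodEven k
spOrder-closed zero = refl
spOrder-closed (suc k) = begin
  (2 * (2 * E) ∸ 1) * (2 * E) * spOrder k  ≡⟨ cong ((2 * (2 * E) ∸ 1) * (2 * E) *_) (spOrder-closed k) ⟩
  (2 * (2 * E) ∸ 1) * (2 * E) * (Q * P)    ≡⟨ regroup (2 * (2 * E) ∸ 1) E Q P ⟩
  2 * (E * Q) * (P * (2 * (2 * E) ∸ 1))    ≡⟨ cong₂ (λ x y → 2 * x * (P * (y ∸ 1))) (2^-square-suc k) (2^-double-suc k) ⟨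
  2 ^ (suc k * suc k) * prodEven (suc k)   ∎
  where
  open ≡-Reasoning
  E = 2 ^ (k * 2)
  Q = 2 ^ (k * k)
  P = prodEven k
  regroup : ∀ Y E Q P → Y * (2 * E) * (Q * P) ≡ 2 * (E * Q) * (P * Y)
  regroup = solve-∀

even-count-formula : ∀ k → count₂ (suc k * 2) (ofParity not) * 2 ^ suc (k * 2) * spOrder k
                        ≡ 2 ^ (suc k * suc k ∸ 1) * prodEven (suc k ∸ 1) * (q2 (2 * suc k) ∸ 1)
even-count-formula k = begin
  count₂ (suc k * 2) (ofParity not) * (2 * E) * spOrder k
    ≡⟨ cong₂ (λ c s → c * (2 * E) * s) (count₂-even (suc (k * 2))) (spOrder-closed k) ⟩
  (2 * E ∸ 1) * (2 * E) * (Q * P)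
    ≡⟨ regroup (2 * E ∸ 1) E Q P ⟩
  E * Q * P * (2 * (2 * E ∸ 1))
    ≡⟨ cong₂ (λ x y → x * P * y) (2^-square-suc k) q2∸1 ⟨
  2 ^ (k + k * suc k) * P * (q2 (2 * suc k) ∸ 1) ∎
  where
  open ≡-Reasoning
  E = 2 ^ (k * 2)
  Q = 2 ^ (k * k)
  P = prodEven k
  regroup : ∀ Z E Q P → Z * (2 * E) * (Q * P) ≡ E * Q * P * (2 * Z)
  regroup = solve-∀
  q2∸1 : q2 (2 * suc k) ∸ 1 ≡ 2 * (2 * E ∸ 1)
  q2∸1 = begin
    (2 ^ (2 * suc k) ∸ 1) ∸ 1  ≡⟨ cong (λ x → (x ∸ 1) ∸ 1) (2^-double-suc k) ⟩
    (2 * (2 * E) ∸ 1) ∸ 1      ≡⟨ ∸-+-assoc (2 * (2 * E)) 1 1 ⟩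
    2 * (2 * E) ∸ 2            ≡⟨ *-distribˡ-∸ 2 (2 * E) 1 ⟨
    2 * (2 * E ∸ 1)            ∎

odd-count-formula : ∀ k → count₂ (suc k * 2) (ofParity (λ b → b)) * 2 ^ suc (k * 2) * spOrder k
                       ≡ 2 ^ (suc k * suc k ∸ 1) * prodEven (suc k ∸ 1) * (q2 (2 * suc k) + 1)
odd-count-formula k = begin
  count₂ (suc k * 2) (ofParity (λ b → b)) * (2 * E) * spOrder k
    ≡⟨ cong₂ (λ c s → c * (2 * E) * s) (count₂-odd (suc (k * 2))) (spOrder-closed k) ⟩
  (2 * E) * (2 * E) * (Q * P)
    ≡⟨ regroup E Q P ⟩
  E * Q * P * (2 * (2 * E))
    ≡⟨ cong₂ (λ x y → x * P * y) (2^-square-suc k) q2+1 ⟨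
  2 ^ (k + k * suc k) * P * (q2 (2 * suc k) + 1) ∎
  where
  open ≡-Reasoning
  E = 2 ^ (k * 2)
  Q = 2 ^ (k * k)
  P = prodEven k
  regroup : ∀ E Q P → (2 * E) * (2 * E) * (Q * P) ≡ E * Q * P * (2 * (2 * E))
  regroup = solve-∀
  q2+1 : q2 (2 * suc k) + 1 ≡ 2 * (2 * E)
  q2+1 = trans (m∸n+n≡m (m^n>0 2 (2 * suc k))) (2^-double-suc k)

SpOnes-card : ∀ k t g → (∀ b → (bit b ≡ t) ⇔ (g b ≡ true)) →
  SpOnes (suc k) t ↔ Fin (count₂ (suc k * 2) (ofParity g) * 2 ^ suc (k * 2) * spOrder k)
SpOnes-card k t g g-spec =
  SpOnes (suc k) t                ↔⟨ SpOnes↔SpOfParity (suc k) t g g-spec ⟩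
  SpOfParity g (suc k + suc k)    ≡⟨ cong (SpOfParity g) (*2≡+ (suc k)) ⟨
  SpOfParity g (suc k * 2)        ↔⟨ SpOfParity-card k g ⟩
  Fin (count₂ (suc k * 2) (ofParity g) * 2 ^ suc (k * 2) * spOrder k) ∎
  where open EquationalReasoning

corollary4p2 : (n : ℕ) → 1 ≤ n →
    (SpEven n ↔ Fin (2 ^ (n * n ∸ 1) * prodEven (n ∸ 1) * (q2 (2 * n) ∸ 1)))
    × (SpOdd n ↔ Fin (2 ^ (n * n ∸ 1) * prodEven (n ∸ 1) * (q2 (2 * n) + 1)))
corollary4p2 (suc k) _ = count 0 not even (even-count-formula k) , count 1 (λ b → b) odd (odd-count-formula k)
  where
  count : ∀ t g → (∀ b → (bit b ≡ t) ⇔ (g b ≡ true)) → ∀ {N} → count₂ (suc k * 2) (ofParity g) * 2 ^ suc (k * 2) * spOrder k ≡ N →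
    SpOnes (suc k) t ↔ Fin N
  count t g g-spec refl = SpOnes-card k t g g-spec
  even : ∀ b → (bit b ≡ 0) ⇔ (not b ≡ true)
  even false = mk⇔ (λ _ → refl) (λ _ → refl)
  even true = mk⇔ (λ ()) (λ ())
  odd : ∀ b → (bit b ≡ 1) ⇔ (b ≡ true)
  odd false = mk⇔ (λ ()) (λ ())
  odd true = mk⇔ (λ _ → refl) (λ _ → refl)
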